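{- Let $q$ be a prime power such that $3$ divides $q^2+q+1$, and let $d=3$. Then $t=\frac{q^2+q+1}{3}$, and with $w_0,\dots,w_{t-1}$ as in the context, $w_u\le2$ for every $u$; moreover, the number $v_j$ of indices $u$ with $w_u=j$ is $v_0=\frac{q^2-2q+1}{3}$, $v_1=q-1$, $v_2=1$.
   Context: Let $\alpha$ be a primitive element of $\mathbb{F}_{q^3}$; identify the points of $PG(2,q)$ with $\mathbb{F}_{q^3}^*/\mathbb{F}_q^*$ and let $P_i$ be the point represented by $\alpha^i$, $i=0,\dots,q^2+q$. For $u=0,\dots,t-1$ let $O_u=\{P_i:i\equiv u\pmod t\}$. Writing $q=p^h$ with $p$ prime, the map $\tau:P_i\mapsto P_{ip\bmod(q^2+q+1)}$ is a collineation of $PG(2,q)$; $\ell_0$ denotes a fixed line left invariant by $\tau$, and $w_u=|\ell_0\cap O_u|$. -}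

module Defs where

open import Level using (0ℓ)
open import Data.Nat using (ℕ; zero; suc; _<_; _≤_; _∸_; NonZero)
  renaming (_+_ to _+ℕ_; _*_ to _*ℕ_; _^_ to _^ℕ_)
open import Data.Nat.DivMod using (_/_; _%_)
open import Data.Fin using (Fin)
open import Data.Fin.Properties using (any?)
  renaming (_≟_ to _≟F_)
open import Data.List using (List; length; filter; upTo)
open import Data.Product using (Σ; ∃; _×_; _,_)
open import Relation.Binary.PropositionalEquality using (_≡_)
open import Relation.Nullary using (¬_; Dec)
open import Relation.Nullary.Decidable using (_×-dec_)
open import Data.Nat using (_≟_)
open import Algebra.Structures using (IsCommutativeRing)

record FieldOn (N : ℕ) : Set where
  field
    _+_ _*_   : Fin N → Fin N → Fin N
    -_        : Fin N → Fin N
    0# 1#     : Fin N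
    isCommutativeRing : IsCommutativeRing _≡_ _+_ _*_ -_ 0# 1#
    0≢1       : ¬ (0# ≡ 1#)
    inverse   : ∀ x → ¬ (x ≡ 0#) → ∃ λ y → x * y ≡ 1#

module FieldDefs {N : ℕ} (F : FieldOn N) where
  open FieldOn F

  pow : Fin N → ℕ → Fin N
  pow x zero    = 1#
  pow x (suc k) = x * pow x k

  Primitive : Fin N → Set
  Primitive α = ¬ (α ≡ 0#) × (∀ i → 0 < i → i < N ∸ 1 → ¬ (pow α i ≡ 1#))

  InSubfield : ℕ → Fin N → Set
  InSubfield q x = pow x q ≡ x

  LinIndep : ℕ → Fin N → Fin N → Set
  LinIndep q a b = ∀ λ' μ → InSubfield q λ' → InSubfield q μ →
                   (λ' * a) + (μ * b) ≡ 0# → (λ' ≡ 0#) × (μ ≡ 0#)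

  InSpan : ℕ → Fin N → Fin N → Fin N → Set
  InSpan q a b x = ∃ λ λ' → ∃ λ μ →
                   InSubfield q λ' × InSubfield q μ × (x ≡ (λ' * a) + (μ * b))

  inSpan? : ∀ q a b x → Dec (InSpan q a b x)
  inSpan? q a b x = any? λ λ' → any? λ μ →
    (pow λ' q ≟F λ') ×-dec ((pow μ q ≟F μ) ×-dec (x ≟F ((λ' * a) + (μ * b))))

  -- The point P_i (represented by α^i) lies on the line ℓ = ⟨a,b⟩_{F_q}
  -- (the projective line of PG(2,q) given by the 2-dim F_q-subspace spanned by a,b).
  OnLine : ℕ → Fin N → Fin N → Fin N → ℕ → Set
  OnLine q α a b i = InSpan q a b (pow α i)

  TauInvariant : ℕ → ℕ → Fin N → Fin N → Fin N → Set
  TauInvariant p q α a b = ∀ i → i < n → OnLine q α a b i →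
                           OnLine q α a b ((i *ℕ p) % n)
    where n = suc (q *ℕ q +ℕ q)

  -- w_u = | ℓ ∩ O_u |, O_u = { P_i : 0 ≤ i < q²+q+1, i ≡ u (mod t) }
  w : (q t : ℕ) → Fin N → Fin N → Fin N → {{NonZero t}} → ℕ → ℕ
  w q t α a b u = length (filter (λ i → ((i % t) ≟ u) ×-dec inSpan? q a b (pow α i))
                                 (upTo (q *ℕ q +ℕ q +ℕ 1)))

  v : (q t : ℕ) → Fin N → Fin N → Fin N → {{NonZero t}} → ℕ → ℕ
  v q t α a b j = length (filter (λ u → w q t α a b u ≟ j) (upTo t))

-- Points of PG(2,q) are the powers α^i, i < n = q² + q + 1, up to 𝔽q-scalars, and ℓ₀ is a 2-dimensional
-- 𝔽q-subspace ℓ of 𝔽_{q³}. Multiplication by β = α^t permutes the points in the orbits {P_u, P_{u+t}, P_{u+2t}},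
-- and w_u counts the points of such an orbit on ℓ. Two facts about ℓ drive the proof: it contains q + 1 points,
-- so Σ w_u = q + 1; and ℓ ∩ β⁻¹ℓ is a single point, so Σ C(w_u, 2) = 1. The intersection is nonzero because
-- two planes of the 3-dimensional 𝔽q-space 𝔽_{q³} meet, and it is not all of ℓ because βℓ = ℓ would make β a
-- root of a quadratic over 𝔽q, whereas β ∉ 𝔽q has the three distinct conjugates β, β^q, β^(q²). The two sums
-- force one orbit to meet ℓ twice, q - 1 orbits once and none three times, so v₂ = 1, v₁ = q - 1, v₀ = t - q.
module Submission where

open import Level using (0ℓ)
open import Algebra.Bundles using (CommutativeRing)
import Algebra.Properties.AbelianGroup
import Algebra.Properties.CommutativeSemigroup
import Algebra.Properties.CommutativeSemiring.Binomial
import Algebra.Properties.CommutativeSemiring.Exp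
import Algebra.Properties.Ring
import Algebra.Properties.Semiring.Exp
import Algebra.Properties.Semiring.Mult
import Algebra.Properties.Semiring.Sum
import Algebra.Solver.Ring.NaturalCoefficients.Default
open import Data.Empty using (⊥-elim)
open import Data.Fin using (Fin; toℕ; inject₁; fromℕ) renaming (zero to fzero; suc to fsuc)
open import Data.Fin.Permutation using (Permutation′; permutation)
open import Data.Fin.Properties using (any?; toℕ-inject₁; toℕ-fromℕ; toℕ<n) renaming (_≟_ to _≟ᶠ_)
open import Data.List using (List; []; _∷_; length; filter; map; upTo; applyUpTo; allFin; cartesianProduct)
open import Data.List.Properties using (filter-notAll; length-++; length-map; length-applyUpTo; length-tabulate)
open import Data.List.Membership.Propositional using (_∈_)
open import Data.List.Membership.Propositional.Properties
  using (∈-allFin; ∈-applyUpTo⁻; ∈-applyUpTo⁺; ∈-map⁻; ∈-map⁺; ∈-filter⁻; ∈-filter⁺; ∈-upTo⁻; ∈-upTo⁺;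
         ∈-cartesianProduct⁺; ∈-cartesianProduct⁻)
open import Data.List.Relation.Binary.Subset.Propositional using (_⊆_)
open import Data.List.Relation.Unary.All as All using ()
open import Data.List.Relation.Unary.Any as Any using (here; there)
open import Data.List.Relation.Unary.AllPairs using ([]; _∷_)
open import Data.List.Relation.Unary.Unique.Propositional using (Unique)
open import Data.List.Relation.Unary.Unique.Propositional.Properties
  using (applyUpTo⁺₁; cartesianProduct⁺; filter⁺; upTo⁺)
open import Data.Nat
  using (ℕ; zero; suc; _^_; _∸_; _≤_; _≰_; _<_; s≤s; z≤n; NonZero; >-nonZero; >-nonZero⁻¹; nonTrivial⇒n>1)
  renaming (_+_ to _+ℕ_; _*_ to _*ℕ_; _≟_ to _≟ℕ_)
open import Data.Nat.Combinatorics using (_C_; nC1≡n; nCn≡1; nCk+nC[k+1]≡[n+1]C[k+1])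
open import Data.Nat.DivMod
  using (_%_; _/_; m≡m%n+[m/n]*n; m%n<n; [m+n]%n≡m%n; m<n⇒m%n≡m; m*[n/m]≡n; m*n/n≡m)
open import Data.Nat.Divisibility
  using (_∣_; divides; ∣⇒≤; m%n≡0⇒n∣m; *-cancelʳ-∣; quotient; m∣n⇒n≡m*quotient)
open import Data.Nat.Primality
  using (Prime; euclidsLemma; ¬prime[0]; ¬prime[1]; prime⇒nonTrivial; prime⇒nonZero)
import Data.Nat.Properties as ℕ
open import Data.Nat.Tactic.RingSolver using (solve-∀)
open import Data.Product using (∃; _×_; _,_; proj₁; proj₂)
open import Data.Sum using (_⊎_; inj₁; inj₂)
open import Function using (_∘_)
open import Relation.Binary.Definitions using (DecidableEquality; tri<; tri≈; tri>)
open import Relation.Binary.PropositionalEquality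
open import Relation.Nullary using (¬_; Dec; yes; no; ¬?; contradiction)
open import Relation.Nullary.Decidable using (_×-dec_)
open import Relation.Unary using (Pred; Decidable)
open import Defs

module Arithmetic where
  open import Data.Nat using (_+_; _*_)

  prime-power≥2 : ∀ {p h} → Prime p → 1 ≤ h → 2 ≤ p ^ h
  prime-power≥2 {p} {suc h} p-prime _ =
    ℕ.≤-trans (nonTrivial⇒n>1 p {{prime⇒nonTrivial p-prime}})
              (ℕ.m≤m*n p (p ^ h) {{ℕ.m^n≢0 p h {{prime⇒nonZero p-prime}}}})

  q³∸1≡[q∸1]*[q²+q+1] : ∀ q → q ^ 3 ∸ 1 ≡ (q ∸ 1) * (q * q + q + 1)
  q³∸1≡[q∸1]*[q²+q+1] zero    = refl
  q³∸1≡[q∸1]*[q²+q+1] (suc r) = cong (_∸ 1) (cube r)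
    where
    cube : ∀ r → suc r * (suc r * (suc r * 1)) ≡ 1 + r * (suc r * suc r + suc r + 1)
    cube = solve-∀

  [1+k]*[1+n]C[1+k]≡[1+n]*nCk : ∀ n k → suc k * (suc n C suc k) ≡ suc n * (n C k)
  [1+k]*[1+n]C[1+k]≡[1+n]*nCk zero    zero    = refl
  [1+k]*[1+n]C[1+k]≡[1+n]*nCk zero    (suc k) = ℕ.*-zeroʳ (suc (suc k))
  [1+k]*[1+n]C[1+k]≡[1+n]*nCk (suc n) zero    =
    trans (ℕ.*-identityˡ _) (trans (nC1≡n (suc (suc n))) (sym (ℕ.*-identityʳ _)))
  [1+k]*[1+n]C[1+k]≡[1+n]*nCk (suc n) (suc k) = begin
    suc (suc k) * (suc (suc n) C suc (suc k))
      ≡⟨ cong (suc (suc k) *_) (nCk+nC[k+1]≡[n+1]C[k+1] (suc n) (suc k)) ⟨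
    suc (suc k) * (X + Y)
      ≡⟨ rearrange₁ k X Y ⟩
    suc k * X + X + suc (suc k) * Y
      ≡⟨ cong₂ (λ u v → u + X + v) ([1+k]*[1+n]C[1+k]≡[1+n]*nCk n k) ([1+k]*[1+n]C[1+k]≡[1+n]*nCk n (suc k)) ⟩
    suc n * (n C k) + X + suc n * (n C suc k)
      ≡⟨ rearrange₂ n (n C k) X (n C suc k) ⟩
    suc n * (n C k + n C suc k) + X
      ≡⟨ cong (λ u → suc n * u + X) (nCk+nC[k+1]≡[n+1]C[k+1] n k) ⟩
    suc n * X + X
      ≡⟨ ℕ.+-comm (suc n * X) X ⟩
    suc (suc n) * X
      ∎
    where
    open ≡-Reasoning
    X Y : ℕ
    X = suc n C suc k
    Y = suc n C suc (suc k)
    rearrange₁ : ∀ k X Y → suc (suc k) * (X + Y) ≡ suc k * X + X + suc (suc k) * Y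
    rearrange₁ = solve-∀
    rearrange₂ : ∀ n A X B → suc n * A + X + suc n * B ≡ suc n * (A + B) + X
    rearrange₂ = solve-∀

  p∣pCk : ∀ {p k} → Prime p → 0 < k → k < p → p ∣ p C k
  p∣pCk {suc n} {suc k} p-prime _ k<p
    with euclidsLemma (suc k) (suc n C suc k) p-prime
           (divides (n C k) (trans ([1+k]*[1+n]C[1+k]≡[1+n]*nCk n k) (ℕ.*-comm (suc n) _)))
  ... | inj₂ p∣C   = p∣C
  ... | inj₁ p∣1+k = contradiction (∣⇒≤ p∣1+k) (ℕ.<⇒≱ k<p)

  m≡3*[m/3] : ∀ {m t} → 3 ∣ m → t ≡ m / 3 → m ≡ t + (t + t)
  m≡3*[m/3] {m} {t} 3∣m t≡m/3 =
    trans (sym (m*[n/m]≡n 3∣m)) (trans (cong (3 *_) (sym t≡m/3)) (cong (λ x → t + (t + x)) (ℕ.+-identityʳ t)))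

  t∸q≡[q²+1∸2q]/3 : ∀ q t → q * q + q + 1 ≡ t + (t + t) → t ∸ q ≡ (q * q + 1 ∸ 2 * q) / 3
  t∸q≡[q²+1∸2q]/3 q t n≡3t = sym (begin
    (q * q + 1 ∸ 2 * q) / 3   ≡⟨ cong (λ m → (m ∸ 2 * q) / 3) q²+1≡3t∸q ⟩
    (3 * t ∸ q ∸ 2 * q) / 3   ≡⟨ cong (_/ 3) (ℕ.∸-+-assoc (3 * t) q (2 * q)) ⟩
    (3 * t ∸ 3 * q) / 3       ≡⟨ cong (_/ 3) (ℕ.*-distribˡ-∸ 3 t q) ⟨
    3 * (t ∸ q) / 3           ≡⟨ cong (_/ 3) (ℕ.*-comm 3 (t ∸ q)) ⟩
    (t ∸ q) * 3 / 3           ≡⟨ m*n/n≡m (t ∸ q) 3 ⟩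
    t ∸ q                     ∎)
    where
    open ≡-Reasoning
    q²+1≡3t∸q : q * q + 1 ≡ 3 * t ∸ q
    q²+1≡3t∸q = begin
      q * q + 1           ≡⟨ ℕ.m+n∸n≡m (q * q + 1) q ⟨
      q * q + 1 + q ∸ q   ≡⟨ cong (_∸ q) (trans (swap q) n≡3t) ⟩
      t + (t + t) ∸ q     ≡⟨ cong (_∸ q) (triple t) ⟩
      3 * t ∸ q           ∎
      where
      swap : ∀ q → q * q + 1 + q ≡ q * q + q + 1
      swap = solve-∀
      triple : ∀ t → t + (t + t) ≡ 3 * t
      triple = solve-∀

open Arithmetic

module Counting where
  open import Data.Nat using (_+_; _*_; _≟_)
  open import Data.Nat.Properties

  module _ {A : Set} (_≟ᴬ_ : DecidableEquality A) where
    open import Data.List.Membership.DecPropositional _≟ᴬ_ using (_∈?_)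

    unique-⊆⇒length≤ : ∀ {xs ys : List A} → Unique xs → xs ⊆ ys → length xs ≤ length ys
    unique-⊆⇒length≤ {[]}     _            _     = z≤n
    unique-⊆⇒length≤ {x ∷ xs} {ys} (x∉xs ∷ xs!) xs⊆ys =
      ≤-trans (s≤s (unique-⊆⇒length≤ xs! xs⊆ys-x))
              (filter-notAll (λ y → ¬? (x ≟ᴬ y)) ys (Any.map (λ x≡y x≢y → x≢y x≡y) (xs⊆ys (here refl))))
      where
      xs⊆ys-x : xs ⊆ filter (λ y → ¬? (x ≟ᴬ y)) ys
      xs⊆ys-x z∈xs = ∈-filter⁺ (λ y → ¬? (x ≟ᴬ y)) (xs⊆ys (there z∈xs)) (All.lookup x∉xs z∈xs)

    unique-⊆-length≥⇒⊇ : ∀ {xs ys : List A} → Unique xs → xs ⊆ ys → length ys ≤ length xs →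
                         ys ⊆ xs
    unique-⊆-length≥⇒⊇ {xs} {ys} xs! xs⊆ys ys≤xs {z} z∈ys with z ∈? xs
    ... | yes z∈xs = z∈xs
    ... | no  z∉xs = contradiction ys≤xs (<⇒≱ (unique-⊆⇒length≤ z∷xs! z∷xs⊆ys))
      where
      z∷xs! : Unique (z ∷ xs)
      z∷xs! = All.tabulate (λ w∈xs z≡w → z∉xs (subst (_∈ xs) (sym z≡w) w∈xs)) ∷ xs!
      z∷xs⊆ys : z ∷ xs ⊆ ys
      z∷xs⊆ys (here refl)  = z∈ys
      z∷xs⊆ys (there w∈xs) = xs⊆ys w∈xs

    unique-⊆-⊇⇒length≡ : ∀ {xs ys : List A} → Unique xs → Unique ys → xs ⊆ ys → ys ⊆ xs →
                         length xs ≡ length ys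
    unique-⊆-⊇⇒length≡ xs! ys! xs⊆ys ys⊆xs =
      ≤-antisym (unique-⊆⇒length≤ xs! xs⊆ys) (unique-⊆⇒length≤ ys! ys⊆xs)

  unique-map⁺ : ∀ {A B : Set} (f : A → B) {xs : List A} →
                (∀ {x y} → x ∈ xs → y ∈ xs → f x ≡ f y → x ≡ y) → Unique xs → Unique (map f xs)
  unique-map⁺ f {[]}     _   _            = []
  unique-map⁺ f {x ∷ xs} inj (x∉xs ∷ xs!) =
    All.tabulate fx∉ ∷ unique-map⁺ f (λ y∈ z∈ → inj (there y∈) (there z∈)) xs!
    where
    fx∉ : ∀ {z} → z ∈ map f xs → ¬ f x ≡ z
    fx∉ z∈ fx≡z with ∈-map⁻ f z∈
    ... | y , y∈xs , refl = All.lookup x∉xs y∈xs (inj (here refl) (there y∈xs) fx≡z)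

  length-cartesianProduct : ∀ {A B : Set} (xs : List A) (ys : List B) →
                            length (cartesianProduct xs ys) ≡ length xs * length ys
  length-cartesianProduct []       ys = refl
  length-cartesianProduct (x ∷ xs) ys =
    trans (length-++ (map (x ,_) ys)) (cong₂ _+_ (length-map (x ,_) ys) (length-cartesianProduct xs ys))

  𝟙 : ∀ {P : Set} → Dec P → ℕ
  𝟙 (yes _) = 1
  𝟙 (no _)  = 0

  𝟙-yes : ∀ {P : Set} (P? : Dec P) → P → 𝟙 P? ≡ 1
  𝟙-yes (yes _) _ = refl
  𝟙-yes (no ¬p) p = contradiction p ¬p

  𝟙≤1 : ∀ {P : Set} (P? : Dec P) → 𝟙 P? ≤ 1
  𝟙≤1 (yes _) = s≤s z≤n
  𝟙≤1 (no _)  = z≤n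

  𝟙-× : ∀ {P Q : Set} (P? : Dec P) (Q? : Dec Q) → 𝟙 (P? ×-dec Q?) ≡ 𝟙 P? * 𝟙 Q?
  𝟙-× (yes _) (yes _) = refl
  𝟙-× (yes _) (no _)  = refl
  𝟙-× (no _)  _       = refl

  𝟙-cong : ∀ {P Q : Set} (P? : Dec P) (Q? : Dec Q) → (P → Q) → (Q → P) → 𝟙 P? ≡ 𝟙 Q?
  𝟙-cong (yes _) (yes _) _   _   = refl
  𝟙-cong (no _)  (no _)  _   _   = refl
  𝟙-cong (yes p) (no ¬q) p→q _   = contradiction (p→q p) ¬q
  𝟙-cong (no ¬p) (yes q) _   q→p = contradiction (q→p q) ¬p

  ∑< : ℕ → (ℕ → ℕ) → ℕ
  ∑< zero    f = 0
  ∑< (suc m) f = f 0 + ∑< m (f ∘ suc)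

  syntax ∑< m (λ i → e) = ∑[ i < m ] e

  length-filter-applyUpTo : ∀ {A : Set} {P : Pred A _} (P? : Decidable P) (f : ℕ → A) m →
                            length (filter P? (applyUpTo f m)) ≡ ∑[ i < m ] 𝟙 (P? (f i))
  length-filter-applyUpTo P? f zero = refl
  length-filter-applyUpTo P? f (suc m) with P? (f 0)
  ... | yes _ = cong suc (length-filter-applyUpTo P? (f ∘ suc) m)
  ... | no _  = length-filter-applyUpTo P? (f ∘ suc) m

  ∑-cong : ∀ m {f g : ℕ → ℕ} → (∀ i → i < m → f i ≡ g i) → ∑< m f ≡ ∑< m g
  ∑-cong zero    f≡g = refl
  ∑-cong (suc m) f≡g = cong₂ _+_ (f≡g 0 (s≤s z≤n)) (∑-cong m (λ i i<m → f≡g (suc i) (s≤s i<m)))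

  ∑-++ : ∀ m k (f : ℕ → ℕ) → ∑< (m + k) f ≡ ∑< m f + ∑[ i < k ] f (m + i)
  ∑-++ zero    k f = refl
  ∑-++ (suc m) k f = trans (cong (f 0 +_) (∑-++ m k (f ∘ suc))) (sym (+-assoc (f 0) _ _))

  ∑-distrib-+ : ∀ m (f g : ℕ → ℕ) → ∑[ i < m ] (f i + g i) ≡ ∑< m f + ∑< m g
  ∑-distrib-+ zero    f g = refl
  ∑-distrib-+ (suc m) f g =
    trans (cong (f 0 + g 0 +_) (∑-distrib-+ m (f ∘ suc) (g ∘ suc)))
          (+-+-swap (f 0) (g 0) (∑< m (f ∘ suc)) (∑< m (g ∘ suc)))
    where
    +-+-swap : ∀ a b c d → a + b + (c + d) ≡ a + c + (b + d)
    +-+-swap = solve-∀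

  ∑-*ʳ : ∀ m (f : ℕ → ℕ) k → ∑[ i < m ] (f i * k) ≡ ∑< m f * k
  ∑-*ʳ zero    f k = refl
  ∑-*ʳ (suc m) f k = trans (cong (f 0 * k +_) (∑-*ʳ m (f ∘ suc) k)) (sym (*-distribʳ-+ k (f 0) _))

  ∑-comm : ∀ m k (g : ℕ → ℕ → ℕ) → ∑[ i < m ] ∑[ j < k ] g i j ≡ ∑[ j < k ] ∑[ i < m ] g i j
  ∑-comm zero    k g = sym (∑-zero k)
    where
    ∑-zero : ∀ k → ∑[ j < k ] 0 ≡ 0
    ∑-zero zero    = refl
    ∑-zero (suc k) = ∑-zero k
  ∑-comm (suc m) k g = trans (cong (∑[ j < k ] g 0 j +_) (∑-comm m k (g ∘ suc)))
                             (sym (∑-distrib-+ k (g 0) (λ j → ∑[ i < m ] g (suc i) j)))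

  ∑-const-1 : ∀ m → ∑[ i < m ] 1 ≡ m
  ∑-const-1 zero    = refl
  ∑-const-1 (suc m) = cong suc (∑-const-1 m)

  ∑-periodic : ∀ k n (f : ℕ → ℕ) → (∀ i → f (n + i) ≡ f i) → ∑< (k * n) f ≡ k * ∑< n f
  ∑-periodic zero    n f per = refl
  ∑-periodic (suc k) n f per = begin
    ∑< (n + k * n) f                    ≡⟨ ∑-++ n (k * n) f ⟩
    ∑< n f + ∑[ i < k * n ] f (n + i)   ≡⟨ cong (∑< n f +_) (∑-cong (k * n) (λ i _ → per i)) ⟩
    ∑< n f + ∑< (k * n) f               ≡⟨ cong (∑< n f +_) (∑-periodic k n f per) ⟩
    ∑< n f + k * ∑< n f                 ∎
    where open ≡-Reasoning

  ≤-∑ : ∀ m (f : ℕ → ℕ) {i} → i < m → f i ≤ ∑< m f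
  ≤-∑ (suc m) f {zero}  _         = m≤m+n (f 0) _
  ≤-∑ (suc m) f {suc i} (s≤s i<m) = ≤-trans (≤-∑ m (f ∘ suc) i<m) (m≤n+m _ (f 0))

  ∑-𝟙-≡ : ∀ m u (g : ℕ → ℕ) → u < m → ∑[ i < m ] (𝟙 (i ≟ u) * g i) ≡ g u
  ∑-𝟙-≡ (suc m) zero    g _ =
    trans (cong (g 0 + 0 +_) (∑-zero m)) (trans (+-identityʳ _) (+-identityʳ _))
    where
    ∑-zero : ∀ m → ∑[ i < m ] (𝟙 (suc i ≟ 0) * g (suc i)) ≡ 0
    ∑-zero zero    = refl
    ∑-zero (suc m) = ∑-zero m
  ∑-𝟙-≡ (suc m) (suc u) g (s≤s u<m) =
    trans (∑-cong m (λ i _ → cong (_* g (suc i)) (𝟙-suc i))) (∑-𝟙-≡ m u (g ∘ suc) u<m)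
    where
    𝟙-suc : ∀ i → 𝟙 (suc i ≟ suc u) ≡ 𝟙 (i ≟ u)
    𝟙-suc i = 𝟙-cong (suc i ≟ suc u) (i ≟ u) suc-injective (cong suc)

  ∑-blocks₃ : ∀ t (f : ℕ → ℕ) → ∑< (t + (t + t)) f ≡ ∑[ u < t ] (f u + f (t + u) + f (t + (t + u)))
  ∑-blocks₃ t f = begin
    ∑< (t + (t + t)) f
      ≡⟨ ∑-++ t (t + t) f ⟩
    ∑< t f + ∑[ i < t + t ] f (t + i)
      ≡⟨ cong (∑< t f +_) (∑-++ t t (λ i → f (t + i))) ⟩
    ∑< t f + (∑[ u < t ] f (t + u) + ∑[ u < t ] f (t + (t + u)))
      ≡⟨ +-assoc (∑< t f) _ _ ⟨
    ∑< t f + ∑[ u < t ] f (t + u) + ∑[ u < t ] f (t + (t + u))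
      ≡⟨ cong (_+ ∑[ u < t ] f (t + (t + u))) (∑-distrib-+ t f (λ u → f (t + u))) ⟨
    ∑[ u < t ] (f u + f (t + u)) + ∑[ u < t ] f (t + (t + u))
      ≡⟨ ∑-distrib-+ t _ _ ⟨
    ∑[ u < t ] (f u + f (t + u) + f (t + (t + u)))
      ∎
    where open ≡-Reasoning

  ∑-residue : ∀ t .{{_ : NonZero t}} (g : ℕ → ℕ) {u} → u < t →
              ∑[ i < t + (t + t) ] (𝟙 (i % t ≟ u) * g i) ≡ g u + g (t + u) + g (t + (t + u))
  ∑-residue t g {u} u<t = begin
    ∑[ i < t + (t + t) ] (𝟙 (i % t ≟ u) * g i)
      ≡⟨ ∑-blocks₃ t _ ⟩
    ∑[ v < t ] (block (λ v → v) v + block (t +_) v + block (λ v → t + (t + v)) v)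
      ≡⟨ ∑-distrib-+ t _ _ ⟩
    ∑[ v < t ] (block (λ v → v) v + block (t +_) v) + ∑[ v < t ] block (λ v → t + (t + v)) v
      ≡⟨ cong₂ _+_ (∑-distrib-+ t _ _) (∑-block (λ v → t + (t + v)) t+[t+v]%t≡v) ⟩
    ∑[ v < t ] block (λ v → v) v + ∑[ v < t ] block (t +_) v + g (t + (t + u))
      ≡⟨ cong (_+ g (t + (t + u))) (cong₂ _+_ (∑-block (λ v → v) v%t≡v) (∑-block (t +_) t+v%t≡v)) ⟩
    g u + g (t + u) + g (t + (t + u))
      ∎
    where
    open ≡-Reasoning
    block : (ℕ → ℕ) → ℕ → ℕ
    block o v = 𝟙 (o v % t ≟ u) * g (o v)
    ∑-block : ∀ o → (∀ {v} → v < t → o v % t ≡ v) → ∑[ v < t ] block o v ≡ g (o u)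
    ∑-block o o%t≡ = trans (∑-cong t (λ v v<t → cong (λ x → 𝟙 (x ≟ u) * g (o v)) (o%t≡ v<t)))
                           (∑-𝟙-≡ t u (λ v → g (o v)) u<t)
    v%t≡v : ∀ {v} → v < t → v % t ≡ v
    v%t≡v = m<n⇒m%n≡m
    t+v%t≡v : ∀ {v} → v < t → (t + v) % t ≡ v
    t+v%t≡v {v} v<t = trans (cong (_% t) (+-comm t v)) (trans ([m+n]%n≡m%n v t) (v%t≡v v<t))
    t+[t+v]%t≡v : ∀ {v} → v < t → (t + (t + v)) % t ≡ v
    t+[t+v]%t≡v {v} v<t = trans (cong (_% t) (+-comm t (t + v))) (trans ([m+n]%n≡m%n (t + v) t) (t+v%t≡v v<t))

  pair-products≡C2 : ∀ {x y z} → x ≤ 1 → y ≤ 1 → z ≤ 1 → x * y + y * z + z * x ≡ (x + y + z) C 2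
  pair-products≡C2 {0} {0} {0} _ _ _ = refl
  pair-products≡C2 {0} {0} {1} _ _ _ = refl
  pair-products≡C2 {0} {1} {0} _ _ _ = refl
  pair-products≡C2 {0} {1} {1} _ _ _ = refl
  pair-products≡C2 {1} {0} {0} _ _ _ = refl
  pair-products≡C2 {1} {0} {1} _ _ _ = refl
  pair-products≡C2 {1} {1} {0} _ _ _ = refl
  pair-products≡C2 {1} {1} {1} _ _ _ = refl
  pair-products≡C2 {suc (suc _)} (s≤s ()) _ _
  pair-products≡C2 {y = suc (suc _)} _ (s≤s ()) _
  pair-products≡C2 {z = suc (suc _)} _ _ (s≤s ())

  moments⇒multiplicities : ∀ {t q} c₀ c₁ c₂ c₃ →
    t ≡ c₃ + c₂ + c₁ + c₀ → suc q ≡ 3 * c₃ + 2 * c₂ + c₁ → 1 ≡ 3 * c₃ + c₂ →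
    c₀ ≡ t ∸ q × c₁ ≡ q ∸ 1 × c₂ ≡ 1 × c₃ ≡ 0
  moments⇒multiplicities c₀ c₁ .1 0 refl refl refl = sym (m+n∸m≡n c₁ c₀) , refl , refl , refl
  moments⇒multiplicities c₀ c₁ c₂ (suc c₃) _ _ 1≡3c₃+c₂ =
    contradiction (subst (3 ≤_) (sym 1≡3c₃+c₂) (≤-trans (*-monoʳ-≤ 3 (s≤s z≤n)) (m≤m+n _ c₂))) λ { (s≤s ()) }

  module _ (t : ℕ) (w : ℕ → ℕ) where

    multiplicity : ℕ → ℕ
    multiplicity j = ∑[ u < t ] 𝟙 (w u ≟ j)

    ∑-by-value : ∀ k (f : ℕ → ℕ) → (∀ u → u < t → w u < k) →
                 ∑[ u < t ] f (w u) ≡ ∑[ j < k ] (multiplicity j * f j)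
    ∑-by-value k f w<k = begin
      ∑[ u < t ] f (w u)
        ≡⟨ ∑-cong t (λ u u<t → by-value (w u) (w<k u u<t)) ⟩
      ∑[ u < t ] ∑[ j < k ] (𝟙 (w u ≟ j) * f j)
        ≡⟨ ∑-comm t k (λ u j → 𝟙 (w u ≟ j) * f j) ⟩
      ∑[ j < k ] ∑[ u < t ] (𝟙 (w u ≟ j) * f j)
        ≡⟨ ∑-cong k (λ j _ → ∑-*ʳ t (λ u → 𝟙 (w u ≟ j)) (f j)) ⟩
      ∑[ j < k ] (multiplicity j * f j)
        ∎
      where
      open ≡-Reasoning
      by-value : ∀ a → a < k → f a ≡ ∑[ j < k ] (𝟙 (a ≟ j) * f j)
      by-value a a<k = sym (trans (∑-cong k (λ j _ → cong (_* f j) (𝟙-cong (a ≟ j) (j ≟ a) sym sym)))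
                                  (∑-𝟙-≡ k a f a<k))

    value-distribution : ∀ q → (∀ u → u < t → w u ≤ 3) → ∑< t w ≡ suc q → ∑[ u < t ] (w u C 2) ≡ 1 →
                         (∀ u → u < t → w u ≤ 2)
                         × multiplicity 0 ≡ t ∸ q × multiplicity 1 ≡ q ∸ 1 × multiplicity 2 ≡ 1
    value-distribution q w≤3 ∑w ∑wC2 =
      let c₀≡ , c₁≡ , c₂≡1 , c₃≡0 = moments⇒multiplicities c₀ c₁ c₂ c₃ total weight-sum pair-sum
      in  w≤2 c₃≡0 , c₀≡ , c₁≡ , c₂≡1
      where
      w<4 : ∀ u → u < t → w u < 4
      w<4 u u<t = s≤s (w≤3 u u<t)
      c₀ c₁ c₂ c₃ : ℕ
      c₀ = multiplicity 0
      c₁ = multiplicity 1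
      c₂ = multiplicity 2
      c₃ = multiplicity 3
      total : t ≡ c₃ + c₂ + c₁ + c₀
      total = trans (sym (∑-const-1 t)) (trans (∑-by-value 4 (λ _ → 1) w<4) (normalise c₀ c₁ c₂ c₃))
        where
        normalise : ∀ a b c d → a * 1 + (b * 1 + (c * 1 + (d * 1 + 0))) ≡ d + c + b + a
        normalise = solve-∀
      weight-sum : suc q ≡ 3 * c₃ + 2 * c₂ + c₁
      weight-sum = trans (sym ∑w) (trans (∑-by-value 4 (λ a → a) w<4) (normalise c₀ c₁ c₂ c₃))
        where
        normalise : ∀ a b c d → a * 0 + (b * 1 + (c * 2 + (d * 3 + 0))) ≡ 3 * d + 2 * c + b
        normalise = solve-∀
      pair-sum : 1 ≡ 3 * c₃ + c₂
      pair-sum = trans (sym ∑wC2) (trans (∑-by-value 4 (_C 2) w<4) (normalise c₀ c₁ c₂ c₃))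
        where
        normalise : ∀ a b c d → a * 0 + (b * 0 + (c * 1 + (d * 3 + 0))) ≡ 3 * d + c
        normalise = solve-∀
      w≤2 : c₃ ≡ 0 → ∀ u → u < t → w u ≤ 2
      w≤2 c₃≡0 u u<t = ≤-pred (≤∧≢⇒< (w≤3 u u<t) w≢3)
        where
        w≢3 : w u ≢ 3
        w≢3 w≡3 = contradiction (subst (𝟙 (w u ≟ 3) ≤_) c₃≡0 (≤-∑ t (λ u → 𝟙 (w u ≟ 3)) u<t))
                                (subst (_≰ 0) (sym (𝟙-yes (w u ≟ 3) w≡3)) λ ())

open Counting

module FieldProperties {N : ℕ} (F : FieldOn N) where
  open FieldOn F using (isCommutativeRing; 0≢1; inverse)
  open FieldDefs F using (pow)

  ring : CommutativeRing 0ℓ 0ℓ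
  ring = record { isCommutativeRing = isCommutativeRing }

  open CommutativeRing ring public
    using (_+_; _*_; -_; _-_; 0#; 1#; +-assoc; +-comm; +-identityˡ; +-identityʳ; -‿inverseˡ; -‿inverseʳ;
           *-assoc; *-comm; *-identityˡ; *-identityʳ; zeroˡ; zeroʳ; distribˡ; distribʳ)
  open Algebra.Properties.Ring (CommutativeRing.ring ring) public
    using (-‿distribˡ-*; -‿distribʳ-*; -‿involutive; -0#≈0#; -1*x≈-x)
  open Algebra.Properties.AbelianGroup (CommutativeRing.+-abelianGroup ring) public
    using (⁻¹-∙-comm; inverseʳ-unique; x∙y⁻¹≈ε⇒x≈y) renaming (∙-cancelˡ to +-cancelˡ)
  open Algebra.Properties.CommutativeSemigroup (CommutativeRing.+-commutativeSemigroup ring) public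
    using () renaming (interchange to +-interchange)
  open Algebra.Properties.CommutativeSemigroup (CommutativeRing.*-commutativeSemigroup ring) public
    using () renaming (x∙yz≈y∙xz to x*yz≡y*xz)
  open Algebra.Properties.Semiring.Mult (CommutativeRing.semiring ring) public
    using () renaming (_×_ to _·_)
  open Algebra.Properties.Semiring.Mult (CommutativeRing.semiring ring) using (×-assoc-*; ×1-homo-*)
  module Exp = Algebra.Properties.Semiring.Exp (CommutativeRing.semiring ring)
  module Solver = Algebra.Solver.Ring.NaturalCoefficients.Default (CommutativeRing.commutativeSemiring ring)

  infix 4 _≟_
  _≟_ : DecidableEquality (Fin N)
  _≟_ = _≟ᶠ_

  x-y≡0⇒x≡y : ∀ {x y} → x - y ≡ 0# → x ≡ y
  x-y≡0⇒x≡y {x} {y} = x∙y⁻¹≈ε⇒x≈y x y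

  x≡y⇒x-y≡0 : ∀ {x y} → x ≡ y → x - y ≡ 0#
  x≡y⇒x-y≡0 {x} refl = -‿inverseʳ x

  [x+y]-[x′+y′]≡[x-x′]+[y-y′] : ∀ x y x′ y′ → (x + y) - (x′ + y′) ≡ (x - x′) + (y - y′)
  [x+y]-[x′+y′]≡[x-x′]+[y-y′] x y x′ y′ =
    trans (cong ((x + y) +_) (sym (⁻¹-∙-comm x′ y′))) (+-interchange x y (- x′) (- y′))

  [a-b]*c≡a*c-b*c : ∀ a b c → (a - b) * c ≡ a * c - b * c
  [a-b]*c≡a*c-b*c a b c = trans (distribʳ c a (- b)) (cong (a * c +_) (sym (-‿distribˡ-* b c)))

  x+y-y≡x : ∀ x y → x + y - y ≡ x
  x+y-y≡x x y = trans (+-assoc x y (- y)) (trans (cong (x +_) (-‿inverseʳ y)) (+-identityʳ x))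

  1≢0 : ¬ 1# ≡ 0#
  1≢0 1≡0 = 0≢1 (sym 1≡0)

  inv : ∀ x → ¬ x ≡ 0# → Fin N
  inv x x≢0 = proj₁ (inverse x x≢0)

  inv-inverseʳ : ∀ x (x≢0 : ¬ x ≡ 0#) → x * inv x x≢0 ≡ 1#
  inv-inverseʳ x x≢0 = proj₂ (inverse x x≢0)

  inv≢0 : ∀ {x} (x≢0 : ¬ x ≡ 0#) → ¬ inv x x≢0 ≡ 0#
  inv≢0 {x} x≢0 x⁻¹≡0 = 1≢0 (trans (sym (inv-inverseʳ x x≢0)) (trans (cong (x *_) x⁻¹≡0) (zeroʳ x)))

  inv[x]*[x*y]≡y : ∀ x (x≢0 : ¬ x ≡ 0#) y → inv x x≢0 * (x * y) ≡ y
  inv[x]*[x*y]≡y x x≢0 y = begin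
    inv x x≢0 * (x * y)  ≡⟨ *-assoc _ x y ⟨
    inv x x≢0 * x * y    ≡⟨ cong (_* y) (trans (*-comm _ x) (inv-inverseʳ x x≢0)) ⟩
    1# * y               ≡⟨ *-identityˡ y ⟩
    y                    ∎
    where open ≡-Reasoning

  x*[inv[x]*y]≡y : ∀ x (x≢0 : ¬ x ≡ 0#) y → x * (inv x x≢0 * y) ≡ y
  x*[inv[x]*y]≡y x x≢0 y = begin
    x * (inv x x≢0 * y)  ≡⟨ *-assoc x _ y ⟨
    x * inv x x≢0 * y    ≡⟨ cong (_* y) (inv-inverseʳ x x≢0) ⟩
    1# * y               ≡⟨ *-identityˡ y ⟩
    y                    ∎
    where open ≡-Reasoning

  *-cancelˡ : ∀ {x y z} → ¬ x ≡ 0# → x * y ≡ x * z → y ≡ z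
  *-cancelˡ {x} {y} {z} x≢0 xy≡xz =
    trans (sym (inv[x]*[x*y]≡y x x≢0 y)) (trans (cong (inv x x≢0 *_) xy≡xz) (inv[x]*[x*y]≡y x x≢0 z))

  x*y≡0⇒x≡0∨y≡0 : ∀ {x y} → x * y ≡ 0# → x ≡ 0# ⊎ y ≡ 0#
  x*y≡0⇒x≡0∨y≡0 {x} {y} x*y≡0 with x ≟ 0#
  ... | yes x≡0 = inj₁ x≡0
  ... | no  x≢0 = inj₂ (*-cancelˡ x≢0 (trans x*y≡0 (sym (zeroʳ x))))

  *-≢0 : ∀ {x y} → ¬ x ≡ 0# → ¬ y ≡ 0# → ¬ x * y ≡ 0#
  *-≢0 x≢0 y≢0 x*y≡0 with x*y≡0⇒x≡0∨y≡0 x*y≡0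
  ... | inj₁ x≡0 = x≢0 x≡0
  ... | inj₂ y≡0 = y≢0 y≡0

  pow≡^ : ∀ x n → pow x n ≡ x Exp.^ n
  pow≡^ x zero    = refl
  pow≡^ x (suc n) = cong (x *_) (pow≡^ x n)

  pow-+ : ∀ x m n → pow x (m +ℕ n) ≡ pow x m * pow x n
  pow-+ x m n =
    trans (pow≡^ x (m +ℕ n)) (trans (Exp.^-homo-* x m n) (sym (cong₂ _*_ (pow≡^ x m) (pow≡^ x n))))

  pow-* : ∀ x m n → pow x (m *ℕ n) ≡ pow (pow x m) n
  pow-* x m n =
    trans (pow≡^ x (m *ℕ n))
          (trans (sym (Exp.^-assocʳ x m n)) (sym (trans (pow≡^ (pow x m) n) (cong (Exp._^ n) (pow≡^ x m)))))

  pow-distrib-* : ∀ x y n → pow (x * y) n ≡ pow x n * pow y n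
  pow-distrib-* x y n =
    trans (pow≡^ (x * y) n) (trans (^-distrib-* x y n) (sym (cong₂ _*_ (pow≡^ x n) (pow≡^ y n))))
    where open Algebra.Properties.CommutativeSemiring.Exp (CommutativeRing.commutativeSemiring ring)

  pow-1# : ∀ n → pow 1# n ≡ 1#
  pow-1# zero    = refl
  pow-1# (suc n) = trans (*-identityˡ _) (pow-1# n)

  pow-0# : ∀ n → pow 0# (suc n) ≡ 0#
  pow-0# n = zeroˡ _

  pow-≢0 : ∀ {x} n → ¬ x ≡ 0# → ¬ pow x n ≡ 0#
  pow-≢0 zero    x≢0 = 1≢0
  pow-≢0 (suc n) x≢0 = *-≢0 x≢0 (pow-≢0 n x≢0)

  pow≡0⇒≡0 : ∀ {x} n → pow x (suc n) ≡ 0# → x ≡ 0#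
  pow≡0⇒≡0 {x} n x^n≡0 with x ≟ 0#
  ... | yes x≡0 = x≡0
  ... | no  x≢0 = contradiction x^n≡0 (pow-≢0 (suc n) x≢0)

  -- Translating by 1# permutes the field and so fixes the sum Σ of its elements.
  N·1≡0 : N · 1# ≡ 0#
  N·1≡0 = sym (+-cancelˡ Σ 0# (N · 1#) (begin
    Σ + 0#                   ≡⟨ +-identityʳ Σ ⟩
    Σ                        ≡⟨ sum-permute (λ x → x) translate ⟩
    sum {N} (λ x → x + 1#)   ≡⟨ sum-distrib-+ (λ x → x) (λ _ → 1#) ⟩
    Σ + sum {N} (λ _ → 1#)   ≡⟨ cong (Σ +_) (sum-replicate N) ⟩
    Σ + N · 1#               ∎))
    where
    open ≡-Reasoning
    open Algebra.Properties.Semiring.Sum (CommutativeRing.semiring ring)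
      using (sum; sum-permute; sum-replicate) renaming (∑-distrib-+ to sum-distrib-+)
    Σ : Fin N
    Σ = sum {N} (λ x → x)
    translate : Permutation′ N
    translate = permutation (_+ 1#) (_- 1#) [x-1]+1≡x (λ x → x+y-y≡x x 1#)
      where
      [x-1]+1≡x : ∀ x → x - 1# + 1# ≡ x
      [x-1]+1≡x x = trans (+-assoc x (- 1#) 1#) (trans (cong (x +_) (-‿inverseˡ 1#)) (+-identityʳ x))

  ·-homo-pow : ∀ m e → (m ^ e) · 1# ≡ pow (m · 1#) e
  ·-homo-pow m zero    = +-identityʳ 1#
  ·-homo-pow m (suc e) = trans (×1-homo-* m (m ^ e)) (cong ((m · 1#) *_) (·-homo-pow m e))

  ^·1≡0⇒·1≡0 : ∀ m {e} → 1 ≤ e → (m ^ e) · 1# ≡ 0# → m · 1# ≡ 0#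
  ^·1≡0⇒·1≡0 m {suc e} _ m^e·1≡0 = pow≡0⇒≡0 e (trans (sym (·-homo-pow m (suc e))) m^e·1≡0)

  ·≡·1* : ∀ n z → n · z ≡ (n · 1#) * z
  ·≡·1* n z = trans (cong (n ·_) (sym (*-identityˡ z))) (sym (×-assoc-* n 1# z))

  char-multiple-vanishes : ∀ {m} → m · 1# ≡ 0# → ∀ c z → (c *ℕ m) · z ≡ 0#
  char-multiple-vanishes {m} m·1≡0 c z = begin
    (c *ℕ m) · z                ≡⟨ ·≡·1* (c *ℕ m) z ⟩
    ((c *ℕ m) · 1#) * z         ≡⟨ cong (_* z) (×1-homo-* c m) ⟩
    ((c · 1#) * (m · 1#)) * z   ≡⟨ cong (λ u → ((c · 1#) * u) * z) m·1≡0 ⟩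
    ((c · 1#) * 0#) * z         ≡⟨ cong (_* z) (zeroʳ (c · 1#)) ⟩
    0# * z                      ≡⟨ zeroˡ z ⟩
    0#                          ∎
    where open ≡-Reasoning

  frobenius : ∀ {p} → Prime p → p · 1# ≡ 0# → ∀ x y → pow (x + y) p ≡ pow x p + pow y p
  frobenius {0}               p-prime = contradiction p-prime ¬prime[0]
  frobenius {1}               p-prime = contradiction p-prime ¬prime[1]
  frobenius {p@(suc (suc m))} p-prime p·1≡0 x y = begin
    pow (x + y) p
      ≡⟨ pow≡^ (x + y) p ⟩
    (x + y) Exp.^ p
      ≡⟨ theorem p x y ⟩
    term fzero + sum (λ k → term (fsuc k))
      ≡⟨ cong (term fzero +_) (sum-init-last (λ k → term (fsuc k))) ⟩
    term fzero + (sum (λ k → term (fsuc (inject₁ k))) + term (fsuc (fromℕ (suc m))))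
      ≡⟨ cong₂ (λ a b → term fzero + (a + b)) middle-terms-vanish (term-top _ (cong suc (toℕ-fromℕ (suc m)))) ⟩
    term fzero + (0# + pow x p)
      ≡⟨ cong₂ _+_ term-bottom (+-identityˡ (pow x p)) ⟩
    pow y p + pow x p
      ≡⟨ +-comm (pow y p) (pow x p) ⟩
    pow x p + pow y p
      ∎
    where
    open ≡-Reasoning
    open Algebra.Properties.CommutativeSemiring.Binomial (CommutativeRing.commutativeSemiring ring)
      using (theorem; binomialTerm)
    open Algebra.Properties.Semiring.Sum (CommutativeRing.semiring ring)
      using (sum; sum-init-last; sum-cong-≗; sum-replicate-zero)
    term : Fin (suc p) → Fin N
    term = binomialTerm x y p
    term-bottom : term fzero ≡ pow y p
    term-bottom = trans (+-identityʳ _) (trans (*-identityˡ _) (sym (pow≡^ y p)))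
    term-top : ∀ k → toℕ k ≡ p → term k ≡ pow x p
    term-top k k≡p rewrite k≡p | nCn≡1 p | ℕ.n∸n≡0 p =
      trans (+-identityʳ _) (trans (*-identityʳ _) (sym (pow≡^ x p)))
    middle-terms-vanish : sum (λ k → term (fsuc (inject₁ k))) ≡ 0#
    middle-terms-vanish = trans (sum-cong-≗ vanishes) (sum-replicate-zero (suc m))
      where
      vanishes : ∀ k → term (fsuc (inject₁ k)) ≡ 0#
      vanishes k with p∣pCk p-prime (s≤s z≤n) (s≤s (subst (_< suc m) (sym (toℕ-inject₁ k)) (toℕ<n k)))
      ... | divides c pCk≡c*p =
        trans (cong (_· monomial) pCk≡c*p) (char-multiple-vanishes p·1≡0 c monomial)
        where
        monomial : Fin N
        monomial = x Exp.^ toℕ (fsuc (inject₁ k)) * y Exp.^ (p ∸ toℕ (fsuc (inject₁ k)))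

  frobenius-^ : ∀ {p} → Prime p → p · 1# ≡ 0# →
                ∀ h x y → pow (x + y) (p ^ h) ≡ pow x (p ^ h) + pow y (p ^ h)
  frobenius-^ p-prime p·1≡0 zero    x y =
    trans (*-identityʳ _) (cong₂ _+_ (sym (*-identityʳ x)) (sym (*-identityʳ y)))
  frobenius-^ {p} p-prime p·1≡0 (suc h) x y = begin
    pow (x + y) (p *ℕ p ^ h)                        ≡⟨ pow-* (x + y) p (p ^ h) ⟩
    pow (pow (x + y) p) (p ^ h)                     ≡⟨ cong (λ z → pow z (p ^ h)) (frobenius p-prime p·1≡0 x y) ⟩
    pow (pow x p + pow y p) (p ^ h)                 ≡⟨ frobenius-^ p-prime p·1≡0 h (pow x p) (pow y p) ⟩
    pow (pow x p) (p ^ h) + pow (pow y p) (p ^ h)   ≡⟨ cong₂ _+_ (pow-* x p (p ^ h)) (pow-* y p (p ^ h)) ⟨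
    pow x (p *ℕ p ^ h) + pow y (p *ℕ p ^ h)         ∎
    where open ≡-Reasoning

  distinct-roots-sum : ∀ {l m x y} → x * x ≡ l + m * x → y * y ≡ l + m * y → ¬ x ≡ y → x + y ≡ m
  distinct-roots-sum {l} {m} {x} {y} x-root y-root x≢y =
    trans (cong (x +_) y≡x+d)
          (trans (sym (+-assoc x x d)) (*-cancelˡ d≢0 (trans (*-comm d _) (trans [2x+d]d≡md (*-comm m d)))))
    where
    open Solver using (solve; _:+_; _:*_; _:=_)
    open ≡-Reasoning
    d : Fin N
    d = y - x
    y≡x+d : y ≡ x + d
    y≡x+d = sym (begin
      x + (y - x)     ≡⟨ +-comm x (y - x) ⟩
      y - x + x       ≡⟨ +-assoc y (- x) x ⟩
      y + (- x + x)   ≡⟨ cong (y +_) (-‿inverseˡ x) ⟩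
      y + 0#          ≡⟨ +-identityʳ y ⟩
      y               ∎)
    d≢0 : ¬ d ≡ 0#
    d≢0 d≡0 = x≢y (sym (x-y≡0⇒x≡y d≡0))
    square : ∀ x d → x * x + (x + x + d) * d ≡ (x + d) * (x + d)
    square = solve 2 (λ x d → x :* x :+ (x :+ x :+ d) :* d := (x :+ d) :* (x :+ d)) refl
    linear : ∀ l m x d → l + m * (x + d) ≡ (l + m * x) + m * d
    linear = solve 4 (λ l m x d → l :+ m :* (x :+ d) := (l :+ m :* x) :+ m :* d) refl
    [2x+d]d≡md : (x + x + d) * d ≡ m * d
    [2x+d]d≡md = +-cancelˡ (x * x) _ _ (begin
      x * x + (x + x + d) * d   ≡⟨ square x d ⟩
      (x + d) * (x + d)         ≡⟨ cong (λ z → z * z) y≡x+d ⟨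
      y * y                     ≡⟨ y-root ⟩
      l + m * y                 ≡⟨ cong (λ z → l + m * z) y≡x+d ⟩
      l + m * (x + d)           ≡⟨ linear l m x d ⟩
      l + m * x + m * d         ≡⟨ cong (_+ m * d) x-root ⟨
      x * x + m * d             ∎)

  at-most-two-roots : ∀ {l m x y z} → x * x ≡ l + m * x → y * y ≡ l + m * y → z * z ≡ l + m * z →
                      ¬ x ≡ y → ¬ x ≡ z → y ≡ z
  at-most-two-roots x-root y-root z-root x≢y x≢z =
    +-cancelˡ _ _ _ (trans (distinct-roots-sum x-root y-root x≢y) (sym (distinct-roots-sum x-root z-root x≢z)))

module PrimitiveElement (p h q : ℕ) (p-prime : Prime p) (1≤h : 1 ≤ h) (q≡p^h : q ≡ p ^ h)
                        (F : FieldOn (q ^ 3)) (α : Fin (q ^ 3)) (α-primitive : FieldDefs.Primitive F α) where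
  open FieldDefs F
  open FieldProperties F public

  N n r M : ℕ
  N = q ^ 3
  n = q *ℕ q +ℕ q +ℕ 1
  r = q ∸ 1
  M = N ∸ 1

  q≥2 : 2 ≤ q
  q≥2 = subst (2 ≤_) (sym q≡p^h) (prime-power≥2 p-prime 1≤h)

  q≡1+r : q ≡ suc r
  q≡1+r = sym (ℕ.m+[n∸m]≡n (ℕ.≤-trans (s≤s z≤n) q≥2))

  M≡r*n : M ≡ r *ℕ n
  M≡r*n = q³∸1≡[q∸1]*[q²+q+1] q

  N≡1+M : N ≡ suc M
  N≡1+M = sym (ℕ.m+[n∸m]≡n (ℕ.^-monoˡ-≤ 3 (ℕ.≤-trans (s≤s z≤n) q≥2)))

  instance
    r≢0 : NonZero r
    r≢0 = >-nonZero (ℕ.≤-pred (subst (2 ≤_) q≡1+r q≥2))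
    n≢0 : NonZero n
    n≢0 = >-nonZero (ℕ.m≤n+m 1 (q *ℕ q +ℕ q))
    M≢0 : NonZero M
    M≢0 = subst NonZero (sym M≡r*n) (ℕ.m*n≢0 r n)

  α≢0 : ¬ α ≡ 0#
  α≢0 = proj₁ α-primitive

  pow-≡⇒pow-∸≡1 : ∀ x {i j} → ¬ x ≡ 0# → i ≤ j → pow x i ≡ pow x j → pow x (j ∸ i) ≡ 1#
  pow-≡⇒pow-∸≡1 x {i} {j} x≢0 i≤j xⁱ≡xʲ = sym (*-cancelˡ (pow-≢0 i x≢0) (begin
    pow x i * 1#              ≡⟨ *-identityʳ _ ⟩
    pow x i                   ≡⟨ xⁱ≡xʲ ⟩
    pow x j                   ≡⟨ cong (pow x) (ℕ.m+[n∸m]≡n i≤j) ⟨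
    pow x (i +ℕ (j ∸ i))      ≡⟨ pow-+ x i (j ∸ i) ⟩
    pow x i * pow x (j ∸ i)   ∎))
    where open ≡-Reasoning

  pow-α≡1⇒≡0 : ∀ {k} → k < M → pow α k ≡ 1# → k ≡ 0
  pow-α≡1⇒≡0 {zero}  _   _    = refl
  pow-α≡1⇒≡0 {suc k} k<M αᵏ≡1 = contradiction αᵏ≡1 (proj₂ α-primitive (suc k) (s≤s z≤n) k<M)

  pow-α-<-injective : ∀ {i j} → i < j → j < M → ¬ pow α i ≡ pow α j
  pow-α-<-injective {i} {j} i<j j<M αⁱ≡αʲ =
    ℕ.<⇒≢ (ℕ.m<n⇒0<n∸m i<j) (sym (pow-α≡1⇒≡0 j∸i<M (pow-≡⇒pow-∸≡1 α α≢0 (ℕ.<⇒≤ i<j) αⁱ≡αʲ)))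
    where
    j∸i<M : j ∸ i < M
    j∸i<M = ℕ.≤-trans (s≤s (ℕ.m∸n≤m j i)) j<M

  pow-α-injective : ∀ {i j} → i < M → j < M → pow α i ≡ pow α j → i ≡ j
  pow-α-injective {i} {j} i<M j<M αⁱ≡αʲ with ℕ.<-cmp i j
  ... | tri< i<j _ _ = contradiction αⁱ≡αʲ (pow-α-<-injective i<j j<M)
  ... | tri≈ _ i≡j _ = i≡j
  ... | tri> _ _ j<i = contradiction (sym αⁱ≡αʲ) (pow-α-<-injective j<i i<M)

  -- The list 0, α⁰, …, α^(M-1) has no repetitions and N = M + 1 entries, so it exhausts the field.
  pow-α-surjective : ∀ x → ¬ x ≡ 0# → ∃ λ k → k < M × pow α k ≡ x
  pow-α-surjective x x≢0
    with unique-⊆-length≥⇒⊇ _≟_ {0# ∷ powers} powers-unique (λ {y} _ → ∈-allFin y) all≤powers (∈-allFin x)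
    where
    powers : List (Fin N)
    powers = applyUpTo (pow α) M
    powers-unique : Unique (0# ∷ powers)
    powers-unique = All.tabulate 0≢power ∷ applyUpTo⁺₁ (pow α) M pow-α-<-injective
      where
      0≢power : ∀ {y} → y ∈ powers → ¬ 0# ≡ y
      0≢power y∈ 0≡y with ∈-applyUpTo⁻ (pow α) y∈
      ... | i , _ , refl = pow-≢0 i α≢0 (sym 0≡y)
    all≤powers : length (allFin N) ≤ length (0# ∷ powers)
    all≤powers = ℕ.≤-reflexive (trans (length-tabulate {n = N} (λ i → i))
                                     (trans N≡1+M (cong suc (sym (length-applyUpTo (pow α) M)))))
  ... | here x≡0   = contradiction x≡0 x≢0
  ... | there x∈ with ∈-applyUpTo⁻ (pow α) x∈
  ...   | k , k<M , x≡αᵏ = k , k<M , sym x≡αᵏ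

  pow-α-M≡1 : pow α M ≡ 1#
  pow-α-M≡1 with pow-α-surjective (pow α M) (pow-≢0 M α≢0)
  ... | zero  , _     , 1≡αᴹ  = sym 1≡αᴹ
  ... | suc k , 1+k<M , αᵏ≡αᴹ = contradiction M∸[1+k]≡0 (ℕ.m>n⇒m∸n≢0 1+k<M)
    where
    M∸[1+k]≡0 : M ∸ suc k ≡ 0
    M∸[1+k]≡0 = pow-α≡1⇒≡0 (ℕ.∸-monoʳ-< (s≤s z≤n) (ℕ.<⇒≤ 1+k<M)) (pow-≡⇒pow-∸≡1 α α≢0 (ℕ.<⇒≤ 1+k<M) αᵏ≡αᴹ)

  pow-α-M* : ∀ c → pow α (M *ℕ c) ≡ 1#
  pow-α-M* c = trans (pow-* α M c) (trans (cong (λ x → pow x c) pow-α-M≡1) (pow-1# c))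

  pow-α-+M* : ∀ i c → pow α (i +ℕ M *ℕ c) ≡ pow α i
  pow-α-+M* i c = trans (pow-+ α i (M *ℕ c)) (trans (cong (pow α i *_) (pow-α-M* c)) (*-identityʳ _))

  pow-α≡1⇒M∣ : ∀ m → pow α m ≡ 1# → M ∣ m
  pow-α≡1⇒M∣ m αᵐ≡1 = m%n≡0⇒n∣m m M (pow-α≡1⇒≡0 (m%n<n m M) α^[m%M]≡1)
    where
    α^[m%M]≡1 : pow α (m % M) ≡ 1#
    α^[m%M]≡1 = begin
      pow α (m % M)                   ≡⟨ pow-α-+M* (m % M) (m / M) ⟨
      pow α (m % M +ℕ M *ℕ (m / M))   ≡⟨ cong (λ k → pow α (m % M +ℕ k)) (ℕ.*-comm M (m / M)) ⟩
      pow α (m % M +ℕ m / M *ℕ M)     ≡⟨ cong (pow α) (m≡m%n+[m/n]*n m M) ⟨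
      pow α m                         ≡⟨ αᵐ≡1 ⟩
      1#                              ∎
      where open ≡-Reasoning

  pow-N : ∀ x → pow x N ≡ x
  pow-N x with x ≟ 0#
  ... | yes refl = trans (cong (pow 0#) N≡1+M) (pow-0# M)
  ... | no  x≢0 with pow-α-surjective x x≢0
  ...   | k , _ , refl = begin
    pow (pow α k) N             ≡⟨ cong (pow (pow α k)) N≡1+M ⟩
    pow α k * pow (pow α k) M   ≡⟨ cong (pow α k *_) (pow-* α k M) ⟨
    pow α k * pow α (k *ℕ M)    ≡⟨ cong (λ e → pow α k * pow α e) (ℕ.*-comm k M) ⟩
    pow α k * pow α (M *ℕ k)    ≡⟨ cong (pow α k *_) (pow-α-M* k) ⟩
    pow α k * 1#                ≡⟨ *-identityʳ _ ⟩
    pow α k                     ∎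
    where open ≡-Reasoning

  p·1≡0 : p · 1# ≡ 0#
  p·1≡0 = ^·1≡0⇒·1≡0 p 1≤h (subst (λ m → m · 1# ≡ 0#) q≡p^h (^·1≡0⇒·1≡0 q {3} (s≤s z≤n) N·1≡0))

  pow-q-+ : ∀ x y → pow (x + y) q ≡ pow x q + pow y q
  pow-q-+ x y = subst (λ m → pow (x + y) m ≡ pow x m + pow y m) (sym q≡p^h) (frobenius-^ p-prime p·1≡0 h x y)

  frob : Fin N → Fin N
  frob x = pow x q

  frob³≡id : ∀ x → frob (frob (frob x)) ≡ x
  frob³≡id x = begin
    pow (pow (pow x q) q) q   ≡⟨ cong (λ y → pow y q) (pow-* x q q) ⟨
    pow (pow x (q *ℕ q)) q    ≡⟨ pow-* x (q *ℕ q) q ⟨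
    pow x (q *ℕ q *ℕ q)       ≡⟨ cong (pow x) (cube q) ⟩
    pow x N                   ≡⟨ pow-N x ⟩
    x                         ∎
    where
    open ≡-Reasoning
    cube : ∀ q → q *ℕ q *ℕ q ≡ q *ℕ (q *ℕ (q *ℕ 1))
    cube = solve-∀

  𝔽q : Fin N → Set
  𝔽q = InSubfield q

  𝔽q-0# : 𝔽q 0#
  𝔽q-0# = trans (cong (pow 0#) q≡1+r) (pow-0# r)

  𝔽q-1# : 𝔽q 1#
  𝔽q-1# = pow-1# q

  𝔽q-+ : ∀ {x y} → 𝔽q x → 𝔽q y → 𝔽q (x + y)
  𝔽q-+ {x} {y} x∈𝔽q y∈𝔽q = trans (pow-q-+ x y) (cong₂ _+_ x∈𝔽q y∈𝔽q)

  𝔽q-* : ∀ {x y} → 𝔽q x → 𝔽q y → 𝔽q (x * y)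
  𝔽q-* {x} {y} x∈𝔽q y∈𝔽q = trans (pow-distrib-* x y q) (cong₂ _*_ x∈𝔽q y∈𝔽q)

  𝔽q-- : ∀ {x} → 𝔽q x → 𝔽q (- x)
  𝔽q-- {x} x∈𝔽q = trans (inverseʳ-unique (pow x q) (pow (- x) q) xᵠ+[-x]ᵠ≡0) (cong -_ x∈𝔽q)
    where
    xᵠ+[-x]ᵠ≡0 : pow x q + pow (- x) q ≡ 0#
    xᵠ+[-x]ᵠ≡0 = trans (sym (pow-q-+ x (- x))) (trans (cong frob (-‿inverseʳ x)) 𝔽q-0#)

  𝔽q-inv : ∀ {x} (x≢0 : ¬ x ≡ 0#) → 𝔽q x → 𝔽q (inv x x≢0)
  𝔽q-inv {x} x≢0 x∈𝔽q = *-cancelˡ x≢0 (begin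
    x * pow (inv x x≢0) q         ≡⟨ cong (_* pow (inv x x≢0) q) x∈𝔽q ⟨
    pow x q * pow (inv x x≢0) q   ≡⟨ pow-distrib-* x (inv x x≢0) q ⟨
    pow (x * inv x x≢0) q         ≡⟨ cong frob (inv-inverseʳ x x≢0) ⟩
    pow 1# q                      ≡⟨ 𝔽q-1# ⟩
    1#                            ≡⟨ inv-inverseʳ x x≢0 ⟨
    x * inv x x≢0                 ∎)
    where open ≡-Reasoning

  frob-root : ∀ {l m x} → 𝔽q l → 𝔽q m → x * x ≡ l + m * x → frob x * frob x ≡ l + m * frob x
  frob-root {l} {m} {x} l∈𝔽q m∈𝔽q x-root = begin
    pow x q * pow x q         ≡⟨ pow-distrib-* x x q ⟨
    pow (x * x) q             ≡⟨ cong frob x-root ⟩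
    pow (l + m * x) q         ≡⟨ pow-q-+ l (m * x) ⟩
    pow l q + pow (m * x) q   ≡⟨ cong₂ _+_ l∈𝔽q (trans (pow-distrib-* m x q) (cong (_* pow x q) m∈𝔽q)) ⟩
    l + m * pow x q           ∎
    where open ≡-Reasoning

  pow-α-n*∈𝔽q : ∀ j → 𝔽q (pow α (n *ℕ j))
  pow-α-n*∈𝔽q j = begin
    pow (pow α (n *ℕ j)) q             ≡⟨ pow-* α (n *ℕ j) q ⟨
    pow α (n *ℕ j *ℕ q)                ≡⟨ cong (λ m → pow α (n *ℕ j *ℕ m)) q≡1+r ⟩
    pow α (n *ℕ j *ℕ suc r)            ≡⟨ cong (pow α) (reorder n j r) ⟩
    pow α (n *ℕ j +ℕ (r *ℕ n) *ℕ j)    ≡⟨ cong (λ m → pow α (n *ℕ j +ℕ m *ℕ j)) M≡r*n ⟨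
    pow α (n *ℕ j +ℕ M *ℕ j)           ≡⟨ pow-α-+M* (n *ℕ j) j ⟩
    pow α (n *ℕ j)                     ∎
    where
    open ≡-Reasoning
    reorder : ∀ n j r → n *ℕ j *ℕ suc r ≡ n *ℕ j +ℕ r *ℕ n *ℕ j
    reorder = solve-∀

  𝔽q-pow-α : ∀ k → 𝔽q (pow α k) → pow α (k *ℕ r) ≡ 1#
  𝔽q-pow-α k αᵏ∈𝔽q = subst (λ e → pow α e ≡ 1#) (ℕ.m+n∸m≡n k (k *ℕ r))
                             (pow-≡⇒pow-∸≡1 α α≢0 (ℕ.m≤m+n k (k *ℕ r)) (begin
    pow α k               ≡⟨ αᵏ∈𝔽q ⟨
    pow (pow α k) q       ≡⟨ pow-* α k q ⟨
    pow α (k *ℕ q)        ≡⟨ cong (λ m → pow α (k *ℕ m)) q≡1+r ⟩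
    pow α (k *ℕ suc r)    ≡⟨ cong (pow α) (ℕ.*-suc k r) ⟩
    pow α (k +ℕ k *ℕ r)   ∎))
    where open ≡-Reasoning

  𝔽q-elements : List (Fin N)
  𝔽q-elements = 0# ∷ applyUpTo (λ j → pow α (n *ℕ j)) r

  ∈𝔽q-elements⇒𝔽q : ∀ {x} → x ∈ 𝔽q-elements → 𝔽q x
  ∈𝔽q-elements⇒𝔽q (here refl) = 𝔽q-0#
  ∈𝔽q-elements⇒𝔽q (there x∈) with ∈-applyUpTo⁻ _ x∈
  ... | j , _ , refl = pow-α-n*∈𝔽q j

  -- α^k lies in 𝔽q iff α^(k(q-1)) = 1, i.e. iff (q-1)(q²+q+1) divides k(q-1).
  𝔽q⇒∈𝔽q-elements : ∀ {x} → 𝔽q x → x ∈ 𝔽q-elements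
  𝔽q⇒∈𝔽q-elements {x} x∈𝔽q with x ≟ 0#
  ... | yes x≡0 = here x≡0
  ... | no  x≢0 with pow-α-surjective x x≢0
  ...   | k , k<M , refl =
    there (subst (_∈ applyUpTo _ r) (cong (pow α) (sym k≡n*j)) (∈-applyUpTo⁺ (λ j → pow α (n *ℕ j)) j<r))
    where
    M≡n*r : M ≡ n *ℕ r
    M≡n*r = trans M≡r*n (ℕ.*-comm r n)
    n∣k : n ∣ k
    n∣k = *-cancelʳ-∣ r (subst (_∣ k *ℕ r) M≡n*r (pow-α≡1⇒M∣ (k *ℕ r) (𝔽q-pow-α k x∈𝔽q)))
    j : ℕ
    j = quotient n∣k
    k≡n*j : k ≡ n *ℕ j
    k≡n*j = m∣n⇒n≡m*quotient n∣k
    j<r : j < r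
    j<r = ℕ.*-cancelˡ-< n j r (subst₂ _<_ k≡n*j M≡n*r k<M)

  𝔽q-elements-unique : Unique 𝔽q-elements
  𝔽q-elements-unique = All.tabulate 0≢element ∷ applyUpTo⁺₁ _ r n*-injective
    where
    0≢element : ∀ {y} → y ∈ applyUpTo (λ j → pow α (n *ℕ j)) r → ¬ 0# ≡ y
    0≢element y∈ 0≡y with ∈-applyUpTo⁻ _ y∈
    ... | j , _ , refl = pow-≢0 (n *ℕ j) α≢0 (sym 0≡y)
    n*-injective : ∀ {i j} → i < j → j < r → ¬ pow α (n *ℕ i) ≡ pow α (n *ℕ j)
    n*-injective {i} {j} i<j j<r =
      pow-α-<-injective (ℕ.*-monoʳ-< n i<j) (subst (n *ℕ j <_) (trans (ℕ.*-comm n r) (sym M≡r*n)) (ℕ.*-monoʳ-< n j<r))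

  length-𝔽q-elements : length 𝔽q-elements ≡ q
  length-𝔽q-elements = trans (cong suc (length-applyUpTo _ r)) (sym q≡1+r)

  𝔽q-elements-difference : ∀ {a b} → a ∈ 𝔽q-elements → b ∈ 𝔽q-elements → 𝔽q (a - b)
  𝔽q-elements-difference a∈ b∈ = 𝔽q-+ (∈𝔽q-elements⇒𝔽q a∈) (𝔽q-- (∈𝔽q-elements⇒𝔽q b∈))

  combination-+ : ∀ a a′ b b′ u v → (a + a′) * u + (b + b′) * v ≡ (a * u + b * v) + (a′ * u + b′ * v)
  combination-+ a a′ b b′ u v =
    trans (cong₂ _+_ (distribʳ u a a′) (distribʳ v b b′)) (+-interchange (a * u) (a′ * u) (b * v) (b′ * v))

  combination-difference : ∀ s t s′ t′ u v →
                           (s - s′) * u + (t - t′) * v ≡ (s * u + t * v) - (s′ * u + t′ * v)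
  combination-difference s t s′ t′ u v =
    trans (cong₂ _+_ ([a-b]*c≡a*c-b*c s s′ u) ([a-b]*c≡a*c-b*c t t′ v))
          (sym ([x+y]-[x′+y′]≡[x-x′]+[y-y′] (s * u) (t * v) (s′ * u) (t′ * v)))

  combination-cancel : ∀ {s t s′ t′ u v} → s * u + t * v ≡ s′ * u + t′ * v →
                       (s - s′) * u + (t - t′) * v ≡ 0#
  combination-cancel {s} {t} {s′} {t′} {u} {v} eq = trans (combination-difference s t s′ t′ u v) (x≡y⇒x-y≡0 eq)

  combination₃-cancel : ∀ {s t k s′ t′ k′ u v w} → s * u + t * v + k * w ≡ s′ * u + t′ * v + k′ * w →
                        (s - s′) * u + (t - t′) * v + (k - k′) * w ≡ 0#
  combination₃-cancel {s} {t} {k} {s′} {t′} {k′} {u} {v} {w} eq = begin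
    (s - s′) * u + (t - t′) * v + (k - k′) * w
      ≡⟨ cong₂ _+_ (combination-difference s t s′ t′ u v) ([a-b]*c≡a*c-b*c k k′ w) ⟩
    ((s * u + t * v) - (s′ * u + t′ * v)) + (k * w - k′ * w)
      ≡⟨ [x+y]-[x′+y′]≡[x-x′]+[y-y′] _ _ _ _ ⟨
    (s * u + t * v + k * w) - (s′ * u + t′ * v + k′ * w)
      ≡⟨ x≡y⇒x-y≡0 eq ⟩
    0#
      ∎
    where open ≡-Reasoning

  combination : Fin N → Fin N → Fin N × Fin N → Fin N
  combination u v (s , t) = s * u + t * v

  span-elements : Fin N → Fin N → List (Fin N)
  span-elements u v = map (combination u v) (cartesianProduct 𝔽q-elements 𝔽q-elements)

  ∈span-elements⇒InSpan : ∀ {u v x} → x ∈ span-elements u v → InSpan q u v x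
  ∈span-elements⇒InSpan {u} {v} x∈ with ∈-map⁻ (combination u v) x∈
  ... | (s , t) , st∈ , refl with ∈-cartesianProduct⁻ 𝔽q-elements 𝔽q-elements st∈
  ...   | s∈ , t∈ = s , t , ∈𝔽q-elements⇒𝔽q s∈ , ∈𝔽q-elements⇒𝔽q t∈ , refl

  InSpan⇒∈span-elements : ∀ {u v x} → InSpan q u v x → x ∈ span-elements u v
  InSpan⇒∈span-elements {u} {v} (s , t , s∈𝔽q , t∈𝔽q , refl) =
    ∈-map⁺ (combination u v) (∈-cartesianProduct⁺ (𝔽q⇒∈𝔽q-elements s∈𝔽q) (𝔽q⇒∈𝔽q-elements t∈𝔽q))

  length-span-elements : ∀ u v → length (span-elements u v) ≡ q *ℕ q
  length-span-elements u v = begin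
    length (span-elements u v)                  ≡⟨ length-map (combination u v) pairs ⟩
    length pairs                                ≡⟨ length-cartesianProduct 𝔽q-elements 𝔽q-elements ⟩
    length 𝔽q-elements *ℕ length 𝔽q-elements    ≡⟨ cong₂ _*ℕ_ length-𝔽q-elements length-𝔽q-elements ⟩
    q *ℕ q                                      ∎
    where
    open ≡-Reasoning
    pairs : List (Fin N × Fin N)
    pairs = cartesianProduct 𝔽q-elements 𝔽q-elements

  span-elements-unique : ∀ {u v} → LinIndep q u v → Unique (span-elements u v)
  span-elements-unique {u} {v} indep =
    unique-map⁺ (combination u v) injective (cartesianProduct⁺ 𝔽q-elements-unique 𝔽q-elements-unique)
    where
    injective : ∀ {x y} → x ∈ _ → y ∈ _ → combination u v x ≡ combination u v y → x ≡ y
    injective {s , t} {s′ , t′} st∈ s′t′∈ eq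
      with ∈-cartesianProduct⁻ 𝔽q-elements 𝔽q-elements st∈
         | ∈-cartesianProduct⁻ 𝔽q-elements 𝔽q-elements s′t′∈
    ... | s∈ , t∈ | s′∈ , t′∈
      with indep (s - s′) (t - t′) (𝔽q-elements-difference s∈ s′∈) (𝔽q-elements-difference t∈ t′∈)
                 (combination-cancel eq)
    ...   | s-s′≡0 , t-t′≡0 = cong₂ _,_ (x-y≡0⇒x≡y s-s′≡0) (x-y≡0⇒x≡y t-t′≡0)

  span-⊆⇒⊇ : ∀ {u v a b} → LinIndep q u v → (∀ {x} → InSpan q u v x → InSpan q a b x) →
             ∀ {x} → InSpan q a b x → InSpan q u v x
  span-⊆⇒⊇ {u} {v} {a} {b} indep uv⊆ab x∈ab =
    ∈span-elements⇒InSpan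
      (unique-⊆-length≥⇒⊇ _≟_ (span-elements-unique indep)
        (λ x∈ → InSpan⇒∈span-elements (uv⊆ab (∈span-elements⇒InSpan x∈)))
        (ℕ.≤-reflexive (trans (length-span-elements a b) (sym (length-span-elements u v))))
        (InSpan⇒∈span-elements x∈ab))

  span-0# : ∀ {u v} → InSpan q u v 0#
  span-0# {u} {v} = 0# , 0# , 𝔽q-0# , 𝔽q-0# , sym (trans (cong₂ _+_ (zeroˡ u) (zeroˡ v)) (+-identityʳ 0#))

  span-left : ∀ {u v} → InSpan q u v u
  span-left {u} {v} =
    1# , 0# , 𝔽q-1# , 𝔽q-0# , sym (trans (cong₂ _+_ (*-identityˡ u) (zeroˡ v)) (+-identityʳ u))

  span-right : ∀ {u v} → InSpan q u v v
  span-right {u} {v} =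
    0# , 1# , 𝔽q-0# , 𝔽q-1# , sym (trans (cong₂ _+_ (zeroˡ u) (*-identityˡ v)) (+-identityˡ v))

  span-+ : ∀ {u v x y} → InSpan q u v x → InSpan q u v y → InSpan q u v (x + y)
  span-+ {u} {v} (s , t , s∈𝔽q , t∈𝔽q , refl) (s′ , t′ , s′∈𝔽q , t′∈𝔽q , refl) =
    s + s′ , t + t′ , 𝔽q-+ s∈𝔽q s′∈𝔽q , 𝔽q-+ t∈𝔽q t′∈𝔽q , sym (combination-+ s s′ t t′ u v)

  span-* : ∀ {u v c x} → 𝔽q c → InSpan q u v x → InSpan q u v (c * x)
  span-* {u} {v} {c} c∈𝔽q (s , t , s∈𝔽q , t∈𝔽q , refl) =
    c * s , c * t , 𝔽q-* c∈𝔽q s∈𝔽q , 𝔽q-* c∈𝔽q t∈𝔽q ,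
    trans (distribˡ c (s * u) (t * v)) (cong₂ _+_ (sym (*-assoc c s u)) (sym (*-assoc c t v)))

  span-- : ∀ {u v x} → InSpan q u v x → InSpan q u v (- x)
  span-- {x = x} x∈ = subst (InSpan q _ _) (-1*x≈-x x) (span-* (𝔽q-- 𝔽q-1#) x∈)

  span-⊆ : ∀ {u v x y} → InSpan q u v x → InSpan q u v y → ∀ {z} → InSpan q x y z → InSpan q u v z
  span-⊆ x∈ y∈ (s , t , s∈𝔽q , t∈𝔽q , refl) = span-+ (span-* s∈𝔽q x∈) (span-* t∈𝔽q y∈)

  dependent⊎independent : ∀ u v → ¬ u ≡ 0# → (∃ λ s → 𝔽q s × v ≡ s * u) ⊎ LinIndep q u v
  dependent⊎independent u v u≢0 with any? (λ s → (pow s q ≟ s) ×-dec (v ≟ s * u))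
  ... | yes (s , s∈𝔽q , v≡su) = inj₁ (s , s∈𝔽q , v≡su)
  ... | no  ¬dependent      = inj₂ independent
    where
    independent : LinIndep q u v
    independent s t s∈𝔽q t∈𝔽q su+tv≡0 with t ≟ 0#
    ... | yes t≡0 with x*y≡0⇒x≡0∨y≡0 {s} {u} (begin
      s * u            ≡⟨ +-identityʳ (s * u) ⟨
      s * u + 0#       ≡⟨ cong (s * u +_) (trans (sym (zeroˡ v)) (cong (_* v) (sym t≡0))) ⟩
      s * u + t * v    ≡⟨ su+tv≡0 ⟩
      0#               ∎)
      where open ≡-Reasoning
    ...   | inj₁ s≡0 = s≡0 , t≡0
    ...   | inj₂ u≡0 = contradiction u≡0 u≢0
    independent s t s∈𝔽q t∈𝔽q su+tv≡0 | no t≢0 =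
      contradiction (- (inv t t≢0 * s) , 𝔽q-- (𝔽q-* (𝔽q-inv t≢0 t∈𝔽q) s∈𝔽q) , v≡) ¬dependent
      where
      v≡ : v ≡ - (inv t t≢0 * s) * u
      v≡ = begin
        v                               ≡⟨ inv[x]*[x*y]≡y t t≢0 v ⟨
        inv t t≢0 * (t * v)             ≡⟨ cong (inv t t≢0 *_) (inverseʳ-unique (s * u) (t * v) su+tv≡0) ⟩
        inv t t≢0 * - (s * u)           ≡⟨ -‿distribʳ-* (inv t t≢0) (s * u) ⟨
        - (inv t t≢0 * (s * u))         ≡⟨ cong -_ (*-assoc (inv t t≢0) s u) ⟨
        - (inv t t≢0 * s * u)           ≡⟨ -‿distribˡ-* (inv t t≢0 * s) u ⟩
        - (inv t t≢0 * s) * u           ∎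
        where open ≡-Reasoning

  LinIndep₃ : Fin N → Fin N → Fin N → Set
  LinIndep₃ u v w =
    ∀ s t k → 𝔽q s → 𝔽q t → 𝔽q k → s * u + t * v + k * w ≡ 0# → s ≡ 0# × t ≡ 0# × k ≡ 0#

  combination₃ : Fin N → Fin N → Fin N → Fin N × Fin N × Fin N → Fin N
  combination₃ u v w (s , t , k) = s * u + t * v + k * w

  -- An injective combination map from 𝔽q³ into the q³ elements of the field is onto.
  span₃-everything : ∀ {u v w} → LinIndep₃ u v w →
                     ∀ x → ∃ λ s → ∃ λ t → ∃ λ k → 𝔽q s × 𝔽q t × 𝔽q k × x ≡ s * u + t * v + k * w
  span₃-everything {u} {v} {w} indep x
    with ∈-map⁻ (combination₃ u v w)
           (unique-⊆-length≥⇒⊇ _≟_ elements-unique (λ {y} _ → ∈-allFin y) all≤elements (∈-allFin x))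
    where
    pairs : List (Fin N × Fin N)
    pairs = cartesianProduct 𝔽q-elements 𝔽q-elements
    triples : List (Fin N × Fin N × Fin N)
    triples = cartesianProduct 𝔽q-elements pairs
    elements : List (Fin N)
    elements = map (combination₃ u v w) triples
    elements-unique : Unique elements
    elements-unique = unique-map⁺ (combination₃ u v w) injective
                                  (cartesianProduct⁺ 𝔽q-elements-unique
                                                     (cartesianProduct⁺ 𝔽q-elements-unique 𝔽q-elements-unique))
      where
      injective : ∀ {x y} → x ∈ triples → y ∈ triples → combination₃ u v w x ≡ combination₃ u v w y → x ≡ y
      injective {s , t , k} {s′ , t′ , k′} stk∈ s′t′k′∈ eq
        with ∈-cartesianProduct⁻ 𝔽q-elements pairs stk∈ | ∈-cartesianProduct⁻ 𝔽q-elements pairs s′t′k′∈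
      ... | s∈ , tk∈ | s′∈ , t′k′∈
        with ∈-cartesianProduct⁻ 𝔽q-elements 𝔽q-elements tk∈ | ∈-cartesianProduct⁻ 𝔽q-elements 𝔽q-elements t′k′∈
      ...   | t∈ , k∈ | t′∈ , k′∈
        with indep (s - s′) (t - t′) (k - k′)
                   (𝔽q-elements-difference s∈ s′∈) (𝔽q-elements-difference t∈ t′∈) (𝔽q-elements-difference k∈ k′∈)
                   (combination₃-cancel eq)
      ...     | s-s′≡0 , t-t′≡0 , k-k′≡0 =
        cong₂ _,_ (x-y≡0⇒x≡y s-s′≡0) (cong₂ _,_ (x-y≡0⇒x≡y t-t′≡0) (x-y≡0⇒x≡y k-k′≡0))
    all≤elements : length (allFin N) ≤ length elements
    all≤elements = ℕ.≤-reflexive (begin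
      length (allFin N)
        ≡⟨ length-tabulate {n = N} (λ i → i) ⟩
      q *ℕ (q *ℕ (q *ℕ 1))
        ≡⟨ cong (λ m → q *ℕ (q *ℕ m)) (ℕ.*-identityʳ q) ⟩
      q *ℕ (q *ℕ q)
        ≡⟨ cong₂ _*ℕ_ length-𝔽q-elements
                      (trans (length-cartesianProduct 𝔽q-elements 𝔽q-elements)
                             (cong₂ _*ℕ_ length-𝔽q-elements length-𝔽q-elements)) ⟨
      length 𝔽q-elements *ℕ length pairs
        ≡⟨ length-cartesianProduct 𝔽q-elements pairs ⟨
      length triples
        ≡⟨ length-map (combination₃ u v w) triples ⟨
      length elements
        ∎)
      where open ≡-Reasoning
  ... | (s , t , k) , stk∈ , x≡ with ∈-cartesianProduct⁻ 𝔽q-elements _ stk∈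
  ...   | s∈ , tk∈ with ∈-cartesianProduct⁻ 𝔽q-elements 𝔽q-elements tk∈
  ...     | t∈ , k∈ = s , t , k , ∈𝔽q-elements⇒𝔽q s∈ , ∈𝔽q-elements⇒𝔽q t∈ , ∈𝔽q-elements⇒𝔽q k∈ , x≡

  module _ {P : Fin N → Set} (P? : ∀ x → Dec (P x)) where

    count-nonzero-powers : P 0# → ∀ {xs} → Unique xs → (∀ {x} → x ∈ xs → P x) → (∀ {x} → P x → x ∈ xs) →
                           suc (∑[ i < M ] 𝟙 (P? (pow α i))) ≡ length xs
    count-nonzero-powers P0 {xs} xs! ∈xs⇒P P⇒∈xs = begin
      suc (∑[ i < M ] 𝟙 (P? (pow α i)))   ≡⟨ cong suc (length-filter-applyUpTo Q? (λ i → i) M) ⟨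
      suc (length exponents)              ≡⟨ cong suc (length-map (pow α) exponents) ⟨
      length ys                           ≡⟨ unique-⊆-⊇⇒length≡ _≟_ ys! xs! ys⊆xs xs⊆ys ⟩
      length xs                           ∎
      where
      open ≡-Reasoning
      Q? : ∀ i → Dec (P (pow α i))
      Q? i = P? (pow α i)
      exponents : List ℕ
      exponents = filter Q? (upTo M)
      ys : List (Fin N)
      ys = 0# ∷ map (pow α) exponents
      ys! : Unique ys
      ys! = All.tabulate 0≢power
          ∷ unique-map⁺ (pow α) (λ i∈ j∈ → pow-α-injective (exponent<M i∈) (exponent<M j∈)) (filter⁺ Q? (upTo⁺ M))
        where
        exponent<M : ∀ {i} → i ∈ exponents → i < M
        exponent<M i∈ = ∈-upTo⁻ (proj₁ (∈-filter⁻ Q? i∈))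
        0≢power : ∀ {y} → y ∈ map (pow α) exponents → ¬ 0# ≡ y
        0≢power y∈ 0≡y with ∈-map⁻ (pow α) y∈
        ... | i , _ , refl = pow-≢0 i α≢0 (sym 0≡y)
      ys⊆xs : ∀ {y} → y ∈ ys → y ∈ xs
      ys⊆xs (here refl) = P⇒∈xs P0
      ys⊆xs (there y∈) with ∈-map⁻ (pow α) y∈
      ... | i , i∈ , refl = P⇒∈xs (proj₂ (∈-filter⁻ Q? {xs = upTo M} i∈))
      xs⊆ys : ∀ {x} → x ∈ xs → x ∈ ys
      xs⊆ys {x} x∈ with x ≟ 0#
      ... | yes x≡0 = here x≡0
      ... | no  x≢0 with pow-α-surjective x x≢0
      ...   | k , k<M , refl = there (∈-map⁺ (pow α) (∈-filter⁺ Q? (∈-upTo⁺ k<M) (∈xs⇒P x∈)))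

    -- α^n generates 𝔽q^*, so a predicate stable under 𝔽q^* is periodic in the exponent with period n.
    module _ (P-scale : ∀ {c x} → 𝔽q c → ¬ c ≡ 0# → P x → P (c * x)) where

      𝟙-powers-periodic : ∀ i → 𝟙 (P? (pow α (n +ℕ i))) ≡ 𝟙 (P? (pow α i))
      𝟙-powers-periodic i = 𝟙-cong (P? (pow α (n +ℕ i))) (P? (pow α i))
        (λ P[αⁿ⁺ⁱ] → subst P (inv[x]*[x*y]≡y αⁿ αⁿ≢0 (pow α i))
                            (P-scale (𝔽q-inv αⁿ≢0 αⁿ∈𝔽q) (inv≢0 αⁿ≢0) (subst P (pow-+ α n i) P[αⁿ⁺ⁱ])))
        (λ P[αⁱ] → subst P (sym (pow-+ α n i)) (P-scale αⁿ∈𝔽q αⁿ≢0 P[αⁱ]))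
        where
        αⁿ : Fin N
        αⁿ = pow α n
        αⁿ≢0 : ¬ αⁿ ≡ 0#
        αⁿ≢0 = pow-≢0 n α≢0
        αⁿ∈𝔽q : 𝔽q αⁿ
        αⁿ∈𝔽q = subst (λ e → 𝔽q (pow α e)) (ℕ.*-identityʳ n) (pow-α-n*∈𝔽q 1)

      ∑-powers-periodic : ∑[ i < M ] 𝟙 (P? (pow α i)) ≡ r *ℕ ∑[ i < n ] 𝟙 (P? (pow α i))
      ∑-powers-periodic =
        trans (cong (λ m → ∑[ i < m ] 𝟙 (P? (pow α i))) M≡r*n) (∑-periodic r n _ 𝟙-powers-periodic)

module Line (p h q : ℕ) (p-prime : Prime p) (1≤h : 1 ≤ h) (q≡p^h : q ≡ p ^ h)
            (F : FieldOn (q ^ 3)) (α : Fin (q ^ 3)) (α-primitive : FieldDefs.Primitive F α)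
            (a b : Fin (q ^ 3)) (ab-independent : FieldDefs.LinIndep F q a b)
            (t : ℕ) {{_ : NonZero t}} (n≡3t : q *ℕ q +ℕ q +ℕ 1 ≡ t +ℕ (t +ℕ t)) where
  open FieldDefs F
  open PrimitiveElement p h q p-prime 1≤h q≡p^h F α α-primitive
  open Solver using (solve; _:+_; _:*_; _:=_)

  ℓ : Fin N → Set
  ℓ = InSpan q a b

  a≢0 : ¬ a ≡ 0#
  a≢0 a≡0 = 1≢0 (proj₁ (ab-independent 1# 0# 𝔽q-1# 𝔽q-0# 1a+0b≡0))
    where
    1a+0b≡0 : 1# * a + 0# * b ≡ 0#
    1a+0b≡0 = trans (cong₂ _+_ (trans (*-identityˡ a) a≡0) (zeroˡ b)) (+-identityˡ 0#)

  β : Fin N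
  β = pow α t

  β≢0 : ¬ β ≡ 0#
  β≢0 = pow-≢0 t α≢0

  β*[c*x]≡c*[β*x] : ∀ c x → β * (c * x) ≡ c * (β * x)
  β*[c*x]≡c*[β*x] = x*yz≡y*xz β

  M≡3tr : M ≡ t *ℕ r +ℕ (t *ℕ r +ℕ t *ℕ r)
  M≡3tr = trans M≡r*n (trans (cong (r *ℕ_) n≡3t) (distribute t r))
    where
    distribute : ∀ t r → r *ℕ (t +ℕ (t +ℕ t)) ≡ t *ℕ r +ℕ (t *ℕ r +ℕ t *ℕ r)
    distribute = solve-∀

  β∉𝔽q : ¬ 𝔽q β
  β∉𝔽q β∈𝔽q = ℕ.<⇒≢ t*r>0 (sym (pow-α≡1⇒≡0 t*r<M (𝔽q-pow-α t β∈𝔽q)))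
    where
    t*r>0 : 0 < t *ℕ r
    t*r>0 = >-nonZero⁻¹ (t *ℕ r) {{ℕ.m*n≢0 t r}}
    t*r<M : t *ℕ r < M
    t*r<M = subst (t *ℕ r <_) (sym M≡3tr) (ℕ.m<m+n (t *ℕ r) (ℕ.<-≤-trans t*r>0 (ℕ.m≤m+n _ _)))

  -- If βℓ ⊆ ℓ then ℓ = ⟨a, βa⟩, so β is a root of a quadratic over 𝔽q; but its conjugates β, β^q, β^(q²)
  -- are three distinct roots.
  ℓ-not-β-invariant : ¬ (∀ {x} → ℓ x → ℓ (β * x))
  ℓ-not-β-invariant β-invariant with dependent⊎independent a (β * a) a≢0
  ... | inj₁ (s , s∈𝔽q , βa≡sa) = β∉𝔽q (subst 𝔽q (sym β≡s) s∈𝔽q)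
    where
    β≡s : β ≡ s
    β≡s = *-cancelˡ a≢0 (trans (*-comm a β) (trans βa≡sa (*-comm s a)))
  ... | inj₂ a-βa-independent
    with span-⊆⇒⊇ a-βa-independent (span-⊆ span-left (β-invariant span-left))
                  (β-invariant (β-invariant span-left))
  ...   | l , m , l∈𝔽q , m∈𝔽q , β[βa]≡ = β≢frob²β (trans (sym (frob³≡id β)) (cong frob (sym frobβ≡frob²β)))
    where
    β-root : β * β ≡ l + m * β
    β-root = *-cancelˡ a≢0 (begin
      a * (β * β)           ≡⟨ reorder a β ⟩
      β * (β * a)           ≡⟨ β[βa]≡ ⟩
      l * a + m * (β * a)   ≡⟨ factor l m a β ⟩
      a * (l + m * β)       ∎)
      where
      open ≡-Reasoning
      reorder : ∀ a β → a * (β * β) ≡ β * (β * a)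
      reorder = solve 2 (λ a β → a :* (β :* β) := β :* (β :* a)) refl
      factor : ∀ l m a β → l * a + m * (β * a) ≡ a * (l + m * β)
      factor = solve 4 (λ l m a β → l :* a :+ m :* (β :* a) := a :* (l :+ m :* β)) refl
    frobβ-root : frob β * frob β ≡ l + m * frob β
    frobβ-root = frob-root l∈𝔽q m∈𝔽q β-root
    β≢frobβ : ¬ β ≡ frob β
    β≢frobβ β≡frobβ = β∉𝔽q (sym β≡frobβ)
    β≢frob²β : ¬ β ≡ frob (frob β)
    β≢frob²β β≡frob²β = β∉𝔽q (trans (cong frob β≡frob²β) (frob³≡id β))
    frobβ≡frob²β : frob β ≡ frob (frob β)
    frobβ≡frob²β =
      at-most-two-roots β-root frobβ-root (frob-root l∈𝔽q m∈𝔽q frobβ-root) β≢frobβ β≢frob²β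

  β⁻¹ : Fin N
  β⁻¹ = inv β β≢0

  a-b-β⁻¹a-independent : ¬ ℓ (β⁻¹ * a) → LinIndep₃ a b (β⁻¹ * a)
  a-b-β⁻¹a-independent β⁻¹a∉ℓ s t k s∈𝔽q t∈𝔽q k∈𝔽q sa+tb+kβ⁻¹a≡0 with k ≟ 0#
  ... | yes k≡0 = proj₁ s≡0×t≡0 , proj₂ s≡0×t≡0 , k≡0
    where
    s≡0×t≡0 : s ≡ 0# × t ≡ 0#
    s≡0×t≡0 = ab-independent s t s∈𝔽q t∈𝔽q (begin
      s * a + t * b                   ≡⟨ +-identityʳ _ ⟨
      s * a + t * b + 0#              ≡⟨ cong (s * a + t * b +_) (trans (sym (zeroˡ _)) (cong (_* _) (sym k≡0))) ⟩
      s * a + t * b + k * (β⁻¹ * a)   ≡⟨ sa+tb+kβ⁻¹a≡0 ⟩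
      0#                              ∎)
      where open ≡-Reasoning
  ... | no  k≢0 = contradiction β⁻¹a∈ℓ β⁻¹a∉ℓ
    where
    β⁻¹a≡ : - (inv k k≢0 * (s * a + t * b)) ≡ β⁻¹ * a
    β⁻¹a≡ = begin
      - (inv k k≢0 * (s * a + t * b))   ≡⟨ -‿distribʳ-* (inv k k≢0) _ ⟩
      inv k k≢0 * - (s * a + t * b)     ≡⟨ cong (inv k k≢0 *_) (inverseʳ-unique _ _ sa+tb+kβ⁻¹a≡0) ⟨
      inv k k≢0 * (k * (β⁻¹ * a))       ≡⟨ inv[x]*[x*y]≡y k k≢0 (β⁻¹ * a) ⟩
      β⁻¹ * a                           ∎
      where open ≡-Reasoning
    β⁻¹a∈ℓ : ℓ (β⁻¹ * a)
    β⁻¹a∈ℓ = subst ℓ β⁻¹a≡ (span-- (span-* (𝔽q-inv k≢0 k∈𝔽q) (s , t , s∈𝔽q , t∈𝔽q , refl)))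

  -- Writing β⁻¹b = s a + t b + k β⁻¹a, the vector x₀ = s a + t b satisfies β x₀ = b - k a.
  ℓ∩β⁻¹ℓ-from-coordinates :
    (∃ λ s → ∃ λ t → ∃ λ k → 𝔽q s × 𝔽q t × 𝔽q k × β⁻¹ * b ≡ s * a + t * b + k * (β⁻¹ * a)) →
    ∃ λ x₀ → ¬ x₀ ≡ 0# × ℓ x₀ × ℓ (β * x₀)
  ℓ∩β⁻¹ℓ-from-coordinates (s , t , k , s∈𝔽q , t∈𝔽q , k∈𝔽q , β⁻¹b≡) =
    x₀ , x₀≢0 , (s , t , s∈𝔽q , t∈𝔽q , refl) , βx₀∈ℓ
    where
    x₀ : Fin N
    x₀ = s * a + t * b
    b≡βx₀+ka : b ≡ β * x₀ + k * a
    b≡βx₀+ka = begin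
      b                               ≡⟨ x*[inv[x]*y]≡y β β≢0 b ⟨
      β * (β⁻¹ * b)                   ≡⟨ cong (β *_) β⁻¹b≡ ⟩
      β * (x₀ + k * (β⁻¹ * a))        ≡⟨ distribˡ β x₀ _ ⟩
      β * x₀ + β * (k * (β⁻¹ * a))    ≡⟨ cong (β * x₀ +_) (β*[c*x]≡c*[β*x] k (β⁻¹ * a)) ⟩
      β * x₀ + k * (β * (β⁻¹ * a))    ≡⟨ cong (λ y → β * x₀ + k * y) (x*[inv[x]*y]≡y β β≢0 a) ⟩
      β * x₀ + k * a                  ∎
      where open ≡-Reasoning
    βx₀∈ℓ : ℓ (β * x₀)
    βx₀∈ℓ = subst ℓ (trans (cong (_- k * a) b≡βx₀+ka) (x+y-y≡x (β * x₀) (k * a)))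
                    (span-+ span-right (span-- (span-* k∈𝔽q span-left)))
    x₀≢0 : ¬ x₀ ≡ 0#
    x₀≢0 x₀≡0 = 1≢0 (trans (sym (-‿involutive 1#)) (trans (cong -_ -1≡0) -0#≈0#))
      where
      b≡ka : b ≡ k * a
      b≡ka = trans b≡βx₀+ka (trans (cong (λ y → β * y + k * a) x₀≡0)
                                   (trans (cong (_+ k * a) (zeroʳ β)) (+-identityˡ _)))
      -1≡0 : - 1# ≡ 0#
      -1≡0 = proj₂ (ab-independent k (- 1#) k∈𝔽q (𝔽q-- 𝔽q-1#)
                     (trans (cong (k * a +_) (-1*x≈-x b))
                            (trans (cong (λ y → k * a + - y) b≡ka) (-‿inverseʳ (k * a)))))

  ℓ∩β⁻¹ℓ-nonzero : ∃ λ x₀ → ¬ x₀ ≡ 0# × ℓ x₀ × ℓ (β * x₀)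
  ℓ∩β⁻¹ℓ-nonzero with inSpan? q a b (β⁻¹ * a)
  ... | yes β⁻¹a∈ℓ =
    β⁻¹ * a , *-≢0 (inv≢0 β≢0) a≢0 , β⁻¹a∈ℓ , subst ℓ (sym (x*[inv[x]*y]≡y β β≢0 a)) span-left
  ... | no  β⁻¹a∉ℓ =
    ℓ∩β⁻¹ℓ-from-coordinates (span₃-everything (a-b-β⁻¹a-independent β⁻¹a∉ℓ) (β⁻¹ * b))

  x₀ : Fin N
  x₀ = proj₁ ℓ∩β⁻¹ℓ-nonzero

  x₀≢0 : ¬ x₀ ≡ 0#
  x₀≢0 = proj₁ (proj₂ ℓ∩β⁻¹ℓ-nonzero)

  x₀∈ℓ : ℓ x₀
  x₀∈ℓ = proj₁ (proj₂ (proj₂ ℓ∩β⁻¹ℓ-nonzero))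

  βx₀∈ℓ : ℓ (β * x₀)
  βx₀∈ℓ = proj₂ (proj₂ (proj₂ ℓ∩β⁻¹ℓ-nonzero))

  -- A second independent vector in ℓ ∩ β⁻¹ℓ would span ℓ and make ℓ β-invariant.
  ℓ∩β⁻¹ℓ⊆𝔽qx₀ : ∀ {x} → ℓ x → ℓ (β * x) → ∃ λ s → 𝔽q s × x ≡ s * x₀
  ℓ∩β⁻¹ℓ⊆𝔽qx₀ {x} x∈ℓ βx∈ℓ with dependent⊎independent x₀ x x₀≢0
  ... | inj₁ x∈𝔽qx₀           = x∈𝔽qx₀
  ... | inj₂ x₀-x-independent = ⊥-elim (ℓ-not-β-invariant β-invariant)
    where
    β-image : ∀ {z} → InSpan q x₀ x z → ℓ (β * z)
    β-image (s , t , s∈𝔽q , t∈𝔽q , refl) =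
      subst ℓ (sym (trans (distribˡ β (s * x₀) (t * x))
                          (cong₂ _+_ (β*[c*x]≡c*[β*x] s x₀) (β*[c*x]≡c*[β*x] t x))))
              (span-+ (span-* s∈𝔽q βx₀∈ℓ) (span-* t∈𝔽q βx∈ℓ))
    β-invariant : ∀ {z} → ℓ z → ℓ (β * z)
    β-invariant z∈ℓ = β-image (span-⊆⇒⊇ x₀-x-independent (span-⊆ x₀∈ℓ x∈ℓ) z∈ℓ)

  Φ? : ∀ x → Dec (ℓ x)
  Φ? = inSpan? q a b

  Ψ : Fin N → Set
  Ψ x = ℓ x × ℓ (β * x)

  Ψ? : ∀ x → Dec (Ψ x)
  Ψ? x = Φ? x ×-dec Φ? (β * x)

  Ψ-scale : ∀ {c x} → 𝔽q c → Ψ x → Ψ (c * x)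
  Ψ-scale {c} {x} c∈𝔽q (x∈ℓ , βx∈ℓ) =
    span-* c∈𝔽q x∈ℓ , subst ℓ (sym (β*[c*x]≡c*[β*x] c x)) (span-* c∈𝔽q βx∈ℓ)

  -- The q² - 1 nonzero vectors of ℓ fall into the classes of the points P_i (i < n) on ℓ, each of size q - 1.
  ∑-ℓ : ∑[ i < n ] 𝟙 (Φ? (pow α i)) ≡ suc q
  ∑-ℓ = ℕ.*-cancelˡ-≡ _ _ r (ℕ.suc-injective (begin
    suc (r *ℕ ∑[ i < n ] 𝟙 (Φ? (pow α i)))
      ≡⟨ cong suc (∑-powers-periodic Φ? (λ c∈𝔽q _ → span-* c∈𝔽q)) ⟨
    suc (∑[ i < M ] 𝟙 (Φ? (pow α i)))
      ≡⟨ count-nonzero-powers Φ? span-0# (span-elements-unique ab-independent)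
                              ∈span-elements⇒InSpan InSpan⇒∈span-elements ⟩
    length (span-elements a b)   ≡⟨ length-span-elements a b ⟩
    q *ℕ q                       ≡⟨ cong (λ m → m *ℕ m) q≡1+r ⟩
    suc r *ℕ suc r               ≡⟨ square r ⟩
    suc (r *ℕ suc (suc r))       ≡⟨ cong (λ m → suc (r *ℕ suc m)) q≡1+r ⟨
    suc (r *ℕ suc q)             ∎))
    where
    open ≡-Reasoning
    square : ∀ r → suc r *ℕ suc r ≡ suc (r *ℕ suc (suc r))
    square = solve-∀

  ∑-ℓ∩β⁻¹ℓ : ∑[ i < n ] 𝟙 (Ψ? (pow α i)) ≡ 1
  ∑-ℓ∩β⁻¹ℓ = ℕ.*-cancelˡ-≡ _ _ r (ℕ.suc-injective (begin
    suc (r *ℕ ∑[ i < n ] 𝟙 (Ψ? (pow α i)))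
      ≡⟨ cong suc (∑-powers-periodic Ψ? (λ c∈𝔽q _ → Ψ-scale c∈𝔽q)) ⟨
    suc (∑[ i < M ] 𝟙 (Ψ? (pow α i)))
      ≡⟨ count-nonzero-powers Ψ? (span-0# , subst ℓ (sym (zeroʳ β)) span-0#)
                              multiples-unique ∈multiples⇒Ψ Ψ⇒∈multiples ⟩
    length multiples     ≡⟨ length-map (_* x₀) 𝔽q-elements ⟩
    length 𝔽q-elements   ≡⟨ length-𝔽q-elements ⟩
    q                    ≡⟨ q≡1+r ⟩
    suc r                ≡⟨ cong suc (ℕ.*-identityʳ r) ⟨
    suc (r *ℕ 1)         ∎))
    where
    open ≡-Reasoning
    multiples : List (Fin N)
    multiples = map (_* x₀) 𝔽q-elements
    multiples-unique : Unique multiples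
    multiples-unique = unique-map⁺ (_* x₀) *x₀-injective 𝔽q-elements-unique
      where
      *x₀-injective : ∀ {s s′} → s ∈ 𝔽q-elements → s′ ∈ 𝔽q-elements → s * x₀ ≡ s′ * x₀ → s ≡ s′
      *x₀-injective _ _ sx₀≡s′x₀ = *-cancelˡ x₀≢0 (trans (*-comm x₀ _) (trans sx₀≡s′x₀ (*-comm _ x₀)))
    ∈multiples⇒Ψ : ∀ {x} → x ∈ multiples → Ψ x
    ∈multiples⇒Ψ x∈ with ∈-map⁻ (_* x₀) x∈
    ... | s , s∈ , refl = Ψ-scale (∈𝔽q-elements⇒𝔽q s∈) (x₀∈ℓ , βx₀∈ℓ)
    Ψ⇒∈multiples : ∀ {x} → Ψ x → x ∈ multiples
    Ψ⇒∈multiples (x∈ℓ , βx∈ℓ) with ℓ∩β⁻¹ℓ⊆𝔽qx₀ x∈ℓ βx∈ℓ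
    ... | s , s∈𝔽q , refl = ∈-map⁺ (_* x₀) (𝔽q⇒∈𝔽q-elements s∈𝔽q)

  onℓ : ℕ → ℕ
  onℓ i = 𝟙 (Φ? (pow α i))

  onℓ-periodic : ∀ i → onℓ (n +ℕ i) ≡ onℓ i
  onℓ-periodic = 𝟙-powers-periodic Φ? (λ c∈𝔽q _ → span-* c∈𝔽q)

  𝟙Ψ≡onℓ*onℓ : ∀ i → 𝟙 (Ψ? (pow α i)) ≡ onℓ i *ℕ onℓ (t +ℕ i)
  𝟙Ψ≡onℓ*onℓ i = trans (𝟙-× (Φ? (pow α i)) (Φ? (β * pow α i)))
                        (cong (λ y → onℓ i *ℕ 𝟙 (Φ? y)) (sym (pow-+ α t i)))

  weight : ℕ → ℕ
  weight = w q t α a b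

  weight≡ : ∀ {u} → u < t → weight u ≡ onℓ u +ℕ onℓ (t +ℕ u) +ℕ onℓ (t +ℕ (t +ℕ u))
  weight≡ {u} u<t = begin
    weight u
      ≡⟨ cong (λ m → length (filter P? (upTo m))) n≡3t ⟩
    length (filter P? (upTo (t +ℕ (t +ℕ t))))
      ≡⟨ length-filter-applyUpTo P? (λ i → i) (t +ℕ (t +ℕ t)) ⟩
    ∑[ i < t +ℕ (t +ℕ t) ] 𝟙 (P? i)
      ≡⟨ ∑-cong (t +ℕ (t +ℕ t)) (λ i _ → 𝟙-× (i % t ≟ℕ u) (Φ? (pow α i))) ⟩
    ∑[ i < t +ℕ (t +ℕ t) ] (𝟙 (i % t ≟ℕ u) *ℕ onℓ i)
      ≡⟨ ∑-residue t onℓ u<t ⟩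
    onℓ u +ℕ onℓ (t +ℕ u) +ℕ onℓ (t +ℕ (t +ℕ u))
      ∎
    where
    open ≡-Reasoning
    P? : ∀ i → Dec (i % t ≡ u × ℓ (pow α i))
    P? i = (i % t ≟ℕ u) ×-dec Φ? (pow α i)

  weight≤3 : ∀ {u} → u < t → weight u ≤ 3
  weight≤3 {u} u<t = subst (_≤ 3) (sym (weight≡ u<t))
                           (ℕ.+-mono-≤ (ℕ.+-mono-≤ (onℓ≤1 u) (onℓ≤1 (t +ℕ u))) (onℓ≤1 (t +ℕ (t +ℕ u))))
    where
    onℓ≤1 : ∀ i → onℓ i ≤ 1
    onℓ≤1 i = 𝟙≤1 (Φ? (pow α i))

  ∑-weight : ∑[ u < t ] weight u ≡ suc q
  ∑-weight = begin
    ∑[ u < t ] weight u                                          ≡⟨ ∑-cong t (λ u u<t → weight≡ u<t) ⟩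
    ∑[ u < t ] (onℓ u +ℕ onℓ (t +ℕ u) +ℕ onℓ (t +ℕ (t +ℕ u)))   ≡⟨ ∑-blocks₃ t onℓ ⟨
    ∑< (t +ℕ (t +ℕ t)) onℓ                                       ≡⟨ cong (λ m → ∑< m onℓ) n≡3t ⟨
    ∑< n onℓ                                                     ≡⟨ ∑-ℓ ⟩
    suc q                                                        ∎
    where open ≡-Reasoning

  -- Since P_{u+3t} = P_u, the pairs of consecutive orbit points both on ℓ are all C(w_u, 2) pairs of the orbit.
  ∑-weight-C2 : ∑[ u < t ] (weight u C 2) ≡ 1
  ∑-weight-C2 = begin
    ∑[ u < t ] (weight u C 2)                                    ≡⟨ ∑-cong t (λ u u<t → pairs u<t) ⟩
    ∑[ u < t ] (ψ u +ℕ ψ (t +ℕ u) +ℕ ψ (t +ℕ (t +ℕ u)))          ≡⟨ ∑-blocks₃ t ψ ⟨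
    ∑< (t +ℕ (t +ℕ t)) ψ                                         ≡⟨ cong (λ m → ∑< m ψ) n≡3t ⟨
    ∑< n ψ                                                       ≡⟨ ∑-ℓ∩β⁻¹ℓ ⟩
    1                                                            ∎
    where
    open ≡-Reasoning
    ψ : ℕ → ℕ
    ψ i = 𝟙 (Ψ? (pow α i))
    pairs : ∀ {u} → u < t → weight u C 2 ≡ ψ u +ℕ ψ (t +ℕ u) +ℕ ψ (t +ℕ (t +ℕ u))
    pairs {u} u<t = begin
      weight u C 2
        ≡⟨ cong (_C 2) (weight≡ u<t) ⟩
      (x +ℕ y +ℕ z) C 2
        ≡⟨ pair-products≡C2 (𝟙≤1 (Φ? _)) (𝟙≤1 (Φ? _)) (𝟙≤1 (Φ? _)) ⟨
      x *ℕ y +ℕ y *ℕ z +ℕ z *ℕ x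
        ≡⟨ cong (λ x′ → x *ℕ y +ℕ y *ℕ z +ℕ z *ℕ x′) x≡onℓ[u+3t] ⟩
      x *ℕ y +ℕ y *ℕ z +ℕ z *ℕ onℓ (t +ℕ (t +ℕ (t +ℕ u)))
        ≡⟨ cong₂ _+ℕ_ (cong₂ _+ℕ_ (𝟙Ψ≡onℓ*onℓ u) (𝟙Ψ≡onℓ*onℓ (t +ℕ u))) (𝟙Ψ≡onℓ*onℓ (t +ℕ (t +ℕ u))) ⟨
      ψ u +ℕ ψ (t +ℕ u) +ℕ ψ (t +ℕ (t +ℕ u))
        ∎
      where
      x y z : ℕ
      x = onℓ u
      y = onℓ (t +ℕ u)
      z = onℓ (t +ℕ (t +ℕ u))
      reassoc : ∀ t u → t +ℕ (t +ℕ t) +ℕ u ≡ t +ℕ (t +ℕ (t +ℕ u))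
      reassoc = solve-∀
      x≡onℓ[u+3t] : x ≡ onℓ (t +ℕ (t +ℕ (t +ℕ u)))
      x≡onℓ[u+3t] = trans (sym (onℓ-periodic u)) (cong onℓ (trans (cong (_+ℕ u) n≡3t) (reassoc t u)))

open import Data.Nat using (_+_; _*_; _≟_)

proposition9 : (p h q : ℕ) → Prime p → 1 ≤ h → q ≡ p ^ h →
    3 ∣ (q * q + q + 1) →
    (F : FieldOn (q ^ 3)) → (α a b : Fin (q ^ 3)) →
    FieldDefs.Primitive F α →
    FieldDefs.LinIndep F q a b →
    FieldDefs.TauInvariant F p q α a b →
    (t : ℕ) → {{_ : NonZero t}} → t ≡ (q * q + q + 1) / 3 →
    (∀ u → u < t → FieldDefs.w F q t α a b u ≤ 2)
    × FieldDefs.v F q t α a b 0 ≡ (q * q + 1 ∸ 2 * q) / 3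
    × FieldDefs.v F q t α a b 1 ≡ q ∸ 1
    × FieldDefs.v F q t α a b 2 ≡ 1
proposition9 p h q p-prime 1≤h q≡p^h 3∣n F α a b α-primitive ab-independent _ t t≡n/3 =
  let w≤2 , v₀≡ , v₁≡ , v₂≡ = value-distribution t weight q (λ u → weight≤3) ∑-weight ∑-weight-C2
  in  w≤2 ,
      trans (v≡multiplicity 0) (trans v₀≡ (t∸q≡[q²+1∸2q]/3 q t n≡3t)) ,
      trans (v≡multiplicity 1) v₁≡ ,
      trans (v≡multiplicity 2) v₂≡
  where
  n≡3t : q * q + q + 1 ≡ t + (t + t)
  n≡3t = m≡3*[m/3] 3∣n t≡n/3
  open Line p h q p-prime 1≤h q≡p^h F α α-primitive a b ab-independent t n≡3t
  v≡multiplicity : ∀ j → FieldDefs.v F q t α a b j ≡ multiplicity t weight j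
  v≡multiplicity j = length-filter-applyUpTo (λ u → weight u ≟ j) (λ u → u) t
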